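{- Let $G=H\oplus K$ be a $2$-sum or a $3$-sum of $2$-connected cubic graphs $H$ and $K$, where $H$ is a snark with $\pi(H)\ge5$ and $K$ is $3$-edge-colourable. If $u$ is an apex of $H$ different from the distinguished vertex of $H$ for the $3$-sum (in the case of a $3$-sum), then $u$ is an apex of $G$.
   Context: Graphs are finite; multiple edges and loops permitted. A snark is a $2$-connected cubic graph with no proper $3$-edge-colouring. $\pi(G)$ is the minimum number of perfect matchings of $G$ whose union is $E(G)$. A vertex $w$ of a graph $X$ is an apex if the graph $X^w$ obtained by inflating $w$ to a triangle (replace $w$ by three mutually adjacent new vertices and re-attach the three edges formerly at $w$ to distinct new vertices) has $\pi(X^w)=4$. $2$-sum $H\oplus_2K$: with distinguished edges $ab\in E(H)$, $cd\in E(K)$, delete them and join $a,b$ bijectively to $c,d$ by two new edges. $3$-sum $H\oplus_3K$: with distinguished vertices $x\in V(H)$, $y\in V(K)$, delete $x,y$ and join the three edge-ends formerly at $x$ bijectively to the three edge-ends formerly at $y$. Vertices of $H$ other than a deleted distinguished vertex are vertices of $G$. -}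

module Defs where

open import Level using (0ℓ)
open import Data.Nat using (ℕ; _<_)
open import Data.Fin using (Fin; zero; suc)
open import Data.Bool using (Bool; true; false; not; _xor_)
import Data.Bool as Bool
open import Data.Unit using (⊤; tt)
open import Data.Empty using (⊥; ⊥-elim)
open import Data.Product using (Σ; _×_; _,_; proj₁; proj₂)
import Data.Product.Properties as ×P
open import Data.Sum using (_⊎_; inj₁; inj₂)
import Data.Sum.Properties as ⊎P
open import Function.Bundles using (_↔_; Inverse)
open import Relation.Nullary using (¬_; Dec; yes; no)
open import Relation.Nullary.Decidable using (False; fromWitnessFalse; toWitnessFalse)
open import Relation.Binary.Definitions using (DecidableEquality)
open import Relation.Binary.PropositionalEquality
open import Axiom.UniquenessOfIdentityProofs using (module Decidable⇒UIP)

-- Multigraphs (loops and parallel edges allowed).  An edge-end (half-edge) is a pair (e , b).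

record Graph : Set₁ where
  field
    V    : Set
    E    : Set
    _≟V_ : DecidableEquality V
    _≟E_ : DecidableEquality E
    end  : E → Bool → V

open Graph public

HalfAt : (G : Graph) → V G → Set
HalfAt G v = Σ (E G × Bool) (λ h → end G (proj₁ h) (proj₂ h) ≡ v)

Finite : Graph → Set
Finite G = Σ ℕ (λ n → V G ↔ Fin n) × Σ ℕ (λ m → E G ↔ Fin m)

-- cubic: exactly three edge-ends at every vertex (a loop counts twice)
Cubic : Graph → Set
Cubic G = ∀ v → HalfAt G v ↔ Fin 3

Loopless : Graph → Set
Loopless G = ∀ e → end G e false ≢ end G e true

data Reach (G : Graph) (ok : E G → Set) : V G → V G → Set where
  here : ∀ {v} → Reach G ok v v
  step : ∀ {w} (e : E G) (b : Bool) → ok e →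
         Reach G ok (end G e (not b)) w → Reach G ok (end G e b) w

Connected : Graph → Set
Connected G = ∀ u v → Reach G (λ _ → ⊤) u v

-- 2-connected (for cubic graphs: connected and bridgeless)
TwoConnected : Graph → Set
TwoConnected G = Connected G × (∀ f u v → Reach G (λ e → e ≢ f) u v)

-- proper 3-edge-colouring: distinct edge-ends at a common vertex get
-- distinct colours (so a loop is never properly coloured)
ThreeEdgeColourable : Graph → Set
ThreeEdgeColourable G =
  Σ (E G → Fin 3) λ c → ∀ (h h' : E G × Bool) → h ≢ h' →
    end G (proj₁ h) (proj₂ h) ≡ end G (proj₁ h') (proj₂ h') →
    c (proj₁ h) ≢ c (proj₁ h')

Snark : Graph → Set
Snark G = TwoConnected G × Cubic G × ¬ ThreeEdgeColourable G

PerfectMatching : (G : Graph) → (E G → Bool) → Set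
PerfectMatching G M =
  ∀ v → Σ (HalfAt G v) (λ h → M (proj₁ (proj₁ h)) ≡ true) ↔ Fin 1

CoverBy : Graph → ℕ → Set
CoverBy G k = Σ (Fin k → E G → Bool) λ Ms →
  (∀ i → PerfectMatching G (Ms i)) × (∀ e → Σ (Fin k) λ i → Ms i e ≡ true)

PMIndexIs : Graph → ℕ → Set
PMIndexIs G k = CoverBy G k × (∀ j → j < k → ¬ CoverBy G j)

PMIndexAtLeast : Graph → ℕ → Set
PMIndexAtLeast G k = ∀ j → j < k → ¬ CoverBy G j

Del : {A : Set} → DecidableEquality A → A → Set
Del {A} _≟_ a = Σ A (λ x → False (x ≟ a))

False-irr : {P : Set} {d : Dec P} (p q : False d) → p ≡ q
False-irr {d = yes _} () _
False-irr {d = no _} _ _ = refl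

Del-≟ : {A : Set} (_≟_ : DecidableEquality A) (a : A) → DecidableEquality (Del _≟_ a)
Del-≟ _≟_ a = ×P.≡-dec _≟_ (λ p q → yes (False-irr p q))

HalfAt-≟ : (G : Graph) (v : V G) → DecidableEquality (HalfAt G v)
HalfAt-≟ G v = ×P.≡-dec (×P.≡-dec (_≟E_ G) Bool._≟_)
                        (λ p q → yes (Decidable⇒UIP.≡-irrelevant (_≟V_ G) p q))

-- Inflation X^w of a vertex w to a triangle.  ι labels the three
-- edge-ends at w by the three new vertices (any labelling gives an
-- isomorphic graph).

next3 : Fin 3 → Fin 3
next3 zero = suc zero
next3 (suc zero) = suc (suc zero)
next3 (suc (suc zero)) = zero

module _ (X : Graph) (w : V X) (ι : HalfAt X w ↔ Fin 3) where
  private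
    V' = Del (_≟V_ X) w ⊎ Fin 3

    place : (e : E X) (b : Bool) → Dec (end X e b ≡ w) → V'
    place e b (yes p) = inj₂ (Inverse.to ι ((e , b) , p))
    place e b (no ¬p) = inj₁ (end X e b , fromWitnessFalse ¬p)

    end' : E X ⊎ Fin 3 → Bool → V'
    end' (inj₁ e) b = place e b (_≟V_ X (end X e b) w)
    end' (inj₂ i) false = inj₂ i
    end' (inj₂ i) true = inj₂ (next3 i)

  inflate : Graph
  inflate = record
    { V = V'
    ; E = E X ⊎ Fin 3
    ; _≟V_ = ⊎P.≡-dec (Del-≟ (_≟V_ X) w) Data.Fin._≟_
    ; _≟E_ = ⊎P.≡-dec (_≟E_ X) Data.Fin._≟_
    ; end = end'
    }

Apex : (X : Graph) → V X → Set
Apex X w = (ι : HalfAt X w ↔ Fin 3) → PMIndexIs (inflate X w ι) 4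

-- 2-sum H ⊕₂ K along edges eH = ab (a = end eH false, b = end eH true)
-- and eK = cd (c = end eK false, d = end eK true).  The new edge
-- `inj₂ (inj₂ j)` joins end eH j to end eK (j xor s); s chooses the
-- bijection {a,b} → {c,d}.

module _ (H K : Graph) (eH : E H) (eK : E K) (s : Bool) where
  private
    E' = Del (_≟E_ H) eH ⊎ (Del (_≟E_ K) eK ⊎ Bool)

    end' : E' → Bool → V H ⊎ V K
    end' (inj₁ (e , _)) b = inj₁ (end H e b)
    end' (inj₂ (inj₁ (e , _))) b = inj₂ (end K e b)
    end' (inj₂ (inj₂ j)) false = inj₁ (end H eH j)
    end' (inj₂ (inj₂ j)) true = inj₂ (end K eK (j xor s))

  twoSum : Graph
  twoSum = record
    { V = V H ⊎ V K
    ; E = E'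
    ; _≟V_ = ⊎P.≡-dec (_≟V_ H) (_≟V_ K)
    ; _≟E_ = ⊎P.≡-dec (Del-≟ (_≟E_ H) eH)
                      (⊎P.≡-dec (Del-≟ (_≟E_ K) eK) Bool._≟_)
    ; end = end'
    }

-- 3-sum H ⊕₃ K at vertices x, y, with bijection φ between the edge-ends
-- at x and the edge-ends at y.  Edges not incident with x (resp. y) are
-- kept; each edge-end h at x gives one new edge joining the other end of
-- h's edge (in H) with the other end of (φ h)'s edge (in K).
-- The construction needs x and y not to carry loops; we pass
-- looplessness of H and K (which follows from 2-connectivity and
-- cubicity, lemma `loopless` below).

NotAt : (G : Graph) → V G → E G → Set
NotAt G x e = False (_≟V_ G (end G e false) x) × False (_≟V_ G (end G e true) x)

otherEnd : (G : Graph) → Loopless G → (x : V G) → HalfAt G x → Del (_≟V_ G) x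
otherEnd G lG x ((e , b) , p) = end G e (not b) , fromWitnessFalse (λ q → lem b p q)
  where
  lem : (b : Bool) → end G e b ≡ x → end G e (not b) ≡ x → ⊥
  lem false p q = lG e (trans p (sym q))
  lem true p q = lG e (trans q (sym p))

module _ (H K : Graph) (x : V H) (y : V K) (φ : HalfAt H x ↔ HalfAt K y)
         (lH : Loopless H) (lK : Loopless K) where
  private
    V' = Del (_≟V_ H) x ⊎ Del (_≟V_ K) y
    E' = Σ (E H) (NotAt H x) ⊎ (Σ (E K) (NotAt K y) ⊎ HalfAt H x)

    keep : (G : Graph) (z : V G) (e : E G) → NotAt G z e → Bool → Del (_≟V_ G) z
    keep G z e (p , q) false = end G e false , p
    keep G z e (p , q) true = end G e true , q

    end' : E' → Bool → V'
    end' (inj₁ (e , n)) b = inj₁ (keep H x e n b)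
    end' (inj₂ (inj₁ (e , n))) b = inj₂ (keep K y e n b)
    end' (inj₂ (inj₂ h)) false = inj₁ (otherEnd H lH x h)
    end' (inj₂ (inj₂ h)) true = inj₂ (otherEnd K lK y (Inverse.to φ h))

    NotAt-≟ : (G : Graph) (z : V G) → DecidableEquality (Σ (E G) (NotAt G z))
    NotAt-≟ G z = ×P.≡-dec (_≟E_ G)
      (λ { (p , q) (p' , q') → yes (cong₂ _,_ (False-irr p p') (False-irr q q')) })

  threeSum : Graph
  threeSum = record
    { V = V'
    ; E = E'
    ; _≟V_ = ⊎P.≡-dec (Del-≟ (_≟V_ H) x) (Del-≟ (_≟V_ K) y)
    ; _≟E_ = ⊎P.≡-dec (NotAt-≟ H x) (⊎P.≡-dec (NotAt-≟ K y) (HalfAt-≟ H x))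
    ; end = end'
    }

fin3 : (p q r z : Fin 3) → p ≢ q → p ≢ r → q ≢ r → z ≢ p → z ≢ q → z ≢ r → ⊥
fin3 zero zero zero zero h _ _ _ _ _ = h refl
fin3 zero zero zero (suc zero) h _ _ _ _ _ = h refl
fin3 zero zero zero (suc (suc zero)) h _ _ _ _ _ = h refl
fin3 zero zero (suc zero) zero h _ _ _ _ _ = h refl
fin3 zero zero (suc zero) (suc zero) h _ _ _ _ _ = h refl
fin3 zero zero (suc zero) (suc (suc zero)) h _ _ _ _ _ = h refl
fin3 zero zero (suc (suc zero)) zero h _ _ _ _ _ = h refl
fin3 zero zero (suc (suc zero)) (suc zero) h _ _ _ _ _ = h refl
fin3 zero zero (suc (suc zero)) (suc (suc zero)) h _ _ _ _ _ = h refl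
fin3 zero (suc zero) zero zero _ h _ _ _ _ = h refl
fin3 zero (suc zero) zero (suc zero) _ h _ _ _ _ = h refl
fin3 zero (suc zero) zero (suc (suc zero)) _ h _ _ _ _ = h refl
fin3 zero (suc zero) (suc zero) zero _ _ h _ _ _ = h refl
fin3 zero (suc zero) (suc zero) (suc zero) _ _ h _ _ _ = h refl
fin3 zero (suc zero) (suc zero) (suc (suc zero)) _ _ h _ _ _ = h refl
fin3 zero (suc zero) (suc (suc zero)) zero _ _ _ h _ _ = h refl
fin3 zero (suc zero) (suc (suc zero)) (suc zero) _ _ _ _ h _ = h refl
fin3 zero (suc zero) (suc (suc zero)) (suc (suc zero)) _ _ _ _ _ h = h refl
fin3 zero (suc (suc zero)) zero zero _ h _ _ _ _ = h refl
fin3 zero (suc (suc zero)) zero (suc zero) _ h _ _ _ _ = h refl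
fin3 zero (suc (suc zero)) zero (suc (suc zero)) _ h _ _ _ _ = h refl
fin3 zero (suc (suc zero)) (suc zero) zero _ _ _ h _ _ = h refl
fin3 zero (suc (suc zero)) (suc zero) (suc zero) _ _ _ _ _ h = h refl
fin3 zero (suc (suc zero)) (suc zero) (suc (suc zero)) _ _ _ _ h _ = h refl
fin3 zero (suc (suc zero)) (suc (suc zero)) zero _ _ h _ _ _ = h refl
fin3 zero (suc (suc zero)) (suc (suc zero)) (suc zero) _ _ h _ _ _ = h refl
fin3 zero (suc (suc zero)) (suc (suc zero)) (suc (suc zero)) _ _ h _ _ _ = h refl
fin3 (suc zero) zero zero zero _ _ h _ _ _ = h refl
fin3 (suc zero) zero zero (suc zero) _ _ h _ _ _ = h refl
fin3 (suc zero) zero zero (suc (suc zero)) _ _ h _ _ _ = h refl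
fin3 (suc zero) zero (suc zero) zero _ h _ _ _ _ = h refl
fin3 (suc zero) zero (suc zero) (suc zero) _ h _ _ _ _ = h refl
fin3 (suc zero) zero (suc zero) (suc (suc zero)) _ h _ _ _ _ = h refl
fin3 (suc zero) zero (suc (suc zero)) zero _ _ _ _ h _ = h refl
fin3 (suc zero) zero (suc (suc zero)) (suc zero) _ _ _ h _ _ = h refl
fin3 (suc zero) zero (suc (suc zero)) (suc (suc zero)) _ _ _ _ _ h = h refl
fin3 (suc zero) (suc zero) zero zero h _ _ _ _ _ = h refl
fin3 (suc zero) (suc zero) zero (suc zero) h _ _ _ _ _ = h refl
fin3 (suc zero) (suc zero) zero (suc (suc zero)) h _ _ _ _ _ = h refl
fin3 (suc zero) (suc zero) (suc zero) zero h _ _ _ _ _ = h refl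
fin3 (suc zero) (suc zero) (suc zero) (suc zero) h _ _ _ _ _ = h refl
fin3 (suc zero) (suc zero) (suc zero) (suc (suc zero)) h _ _ _ _ _ = h refl
fin3 (suc zero) (suc zero) (suc (suc zero)) zero h _ _ _ _ _ = h refl
fin3 (suc zero) (suc zero) (suc (suc zero)) (suc zero) h _ _ _ _ _ = h refl
fin3 (suc zero) (suc zero) (suc (suc zero)) (suc (suc zero)) h _ _ _ _ _ = h refl
fin3 (suc zero) (suc (suc zero)) zero zero _ _ _ _ _ h = h refl
fin3 (suc zero) (suc (suc zero)) zero (suc zero) _ _ _ h _ _ = h refl
fin3 (suc zero) (suc (suc zero)) zero (suc (suc zero)) _ _ _ _ h _ = h refl
fin3 (suc zero) (suc (suc zero)) (suc zero) zero _ h _ _ _ _ = h refl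
fin3 (suc zero) (suc (suc zero)) (suc zero) (suc zero) _ h _ _ _ _ = h refl
fin3 (suc zero) (suc (suc zero)) (suc zero) (suc (suc zero)) _ h _ _ _ _ = h refl
fin3 (suc zero) (suc (suc zero)) (suc (suc zero)) zero _ _ h _ _ _ = h refl
fin3 (suc zero) (suc (suc zero)) (suc (suc zero)) (suc zero) _ _ h _ _ _ = h refl
fin3 (suc zero) (suc (suc zero)) (suc (suc zero)) (suc (suc zero)) _ _ h _ _ _ = h refl
fin3 (suc (suc zero)) zero zero zero _ _ h _ _ _ = h refl
fin3 (suc (suc zero)) zero zero (suc zero) _ _ h _ _ _ = h refl
fin3 (suc (suc zero)) zero zero (suc (suc zero)) _ _ h _ _ _ = h refl
fin3 (suc (suc zero)) zero (suc zero) zero _ _ _ _ h _ = h refl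
fin3 (suc (suc zero)) zero (suc zero) (suc zero) _ _ _ _ _ h = h refl
fin3 (suc (suc zero)) zero (suc zero) (suc (suc zero)) _ _ _ h _ _ = h refl
fin3 (suc (suc zero)) zero (suc (suc zero)) zero _ h _ _ _ _ = h refl
fin3 (suc (suc zero)) zero (suc (suc zero)) (suc zero) _ h _ _ _ _ = h refl
fin3 (suc (suc zero)) zero (suc (suc zero)) (suc (suc zero)) _ h _ _ _ _ = h refl
fin3 (suc (suc zero)) (suc zero) zero zero _ _ _ _ _ h = h refl
fin3 (suc (suc zero)) (suc zero) zero (suc zero) _ _ _ _ h _ = h refl
fin3 (suc (suc zero)) (suc zero) zero (suc (suc zero)) _ _ _ h _ _ = h refl
fin3 (suc (suc zero)) (suc zero) (suc zero) zero _ _ h _ _ _ = h refl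
fin3 (suc (suc zero)) (suc zero) (suc zero) (suc zero) _ _ h _ _ _ = h refl
fin3 (suc (suc zero)) (suc zero) (suc zero) (suc (suc zero)) _ _ h _ _ _ = h refl
fin3 (suc (suc zero)) (suc zero) (suc (suc zero)) zero _ h _ _ _ _ = h refl
fin3 (suc (suc zero)) (suc zero) (suc (suc zero)) (suc zero) _ h _ _ _ _ = h refl
fin3 (suc (suc zero)) (suc zero) (suc (suc zero)) (suc (suc zero)) _ h _ _ _ _ = h refl
fin3 (suc (suc zero)) (suc (suc zero)) zero zero h _ _ _ _ _ = h refl
fin3 (suc (suc zero)) (suc (suc zero)) zero (suc zero) h _ _ _ _ _ = h refl
fin3 (suc (suc zero)) (suc (suc zero)) zero (suc (suc zero)) h _ _ _ _ _ = h refl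
fin3 (suc (suc zero)) (suc (suc zero)) (suc zero) zero h _ _ _ _ _ = h refl
fin3 (suc (suc zero)) (suc (suc zero)) (suc zero) (suc zero) h _ _ _ _ _ = h refl
fin3 (suc (suc zero)) (suc (suc zero)) (suc zero) (suc (suc zero)) h _ _ _ _ _ = h refl
fin3 (suc (suc zero)) (suc (suc zero)) (suc (suc zero)) zero h _ _ _ _ _ = h refl
fin3 (suc (suc zero)) (suc (suc zero)) (suc (suc zero)) (suc zero) h _ _ _ _ _ = h refl
fin3 (suc (suc zero)) (suc (suc zero)) (suc (suc zero)) (suc (suc zero)) h _ _ _ _ _ = h refl

third : (p q : Fin 3) → p ≢ q → Σ (Fin 3) λ k → k ≢ p × k ≢ q
third zero zero h = ⊥-elim (h refl)
third zero (suc zero) h = (suc (suc zero)) , (λ ()) , (λ ())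
third zero (suc (suc zero)) h = (suc zero) , (λ ()) , (λ ())
third (suc zero) zero h = (suc (suc zero)) , (λ ()) , (λ ())
third (suc zero) (suc zero) h = ⊥-elim (h refl)
third (suc zero) (suc (suc zero)) h = zero , (λ ()) , (λ ())
third (suc (suc zero)) zero h = (suc zero) , (λ ()) , (λ ())
third (suc (suc zero)) (suc zero) h = zero , (λ ()) , (λ ())
third (suc (suc zero)) (suc (suc zero)) h = ⊥-elim (h refl)

module _ (G : Graph) where
  private
    halfEq : {v : V G} {h h' : HalfAt G v} → proj₁ h ≡ proj₁ h' → h ≡ h'
    halfEq {v} {(x , p)} {(.x , q)} refl =
      cong (x ,_) (Decidable⇒UIP.≡-irrelevant (_≟V_ G) p q)

    inj : {A B : Set} (ι : A ↔ B) {x y : A} → Inverse.to ι x ≡ Inverse.to ι y → x ≡ y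
    inj ι {x} {y} eq =
      trans (sym (Inverse.strictlyInverseʳ ι x))
            (trans (cong (Inverse.from ι) eq) (Inverse.strictlyInverseʳ ι y))

  loopless : Cubic G → TwoConnected G → Loopless G
  loopless cub (_ , tc) e loop = fin3 ta tb k td' ta≢tb k≢ta' k≢tb' d'≢a d'≢b d'≢k
    where
    v = end G e false
    ι = cub v
    to = Inverse.to ι
    from = Inverse.from ι
    a b : HalfAt G v
    a = (e , false) , refl
    b = (e , true) , sym loop
    ta = to a
    tb = to b
    ta≢tb : ta ≢ tb
    ta≢tb eq with cong (λ h → proj₂ (proj₁ h)) (inj ι eq)
    ... | ()
    K = third ta tb ta≢tb
    k = proj₁ K
    k≢ta' : ta ≢ k
    k≢ta' eq = proj₁ (proj₂ K) (sym eq)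
    k≢tb' : tb ≢ k
    k≢tb' eq = proj₂ (proj₂ K) (sym eq)
    c = from k
    f = proj₁ (proj₁ c)
    bf = proj₂ (proj₁ c)
    tc≡k : to c ≡ k
    tc≡k = Inverse.strictlyInverseˡ ι k
    f≢e : f ≢ e
    f≢e f≡e with bf in eqb
    ... | false = proj₁ (proj₂ K) (trans (sym tc≡k)
                   (cong to (halfEq (cong₂ _,_ f≡e eqb))))
    ... | true = proj₂ (proj₂ K) (trans (sym tc≡k)
                   (cong to (halfEq (cong₂ _,_ f≡e eqb))))
    claim : (d : HalfAt G v) → proj₁ (proj₁ d) ≢ f → proj₁ (proj₁ d) ≡ e
    claim d nf with to d Data.Fin.≟ ta
    ... | yes eq = cong (λ h → proj₁ (proj₁ h)) (inj ι eq)
    ... | no na with to d Data.Fin.≟ tb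
    ... | yes eq = cong (λ h → proj₁ (proj₁ h)) (inj ι eq)
    ... | no nb with to d Data.Fin.≟ k
    ... | yes eq = ⊥-elim (nf (cong (λ h → proj₁ (proj₁ h))
                     (inj ι (trans eq (sym tc≡k)))))
    ... | no nk = ⊥-elim (fin3 ta tb k (to d) ta≢tb k≢ta' k≢tb' na nb nk)
    endE : (b' : Bool) → end G e b' ≡ v
    endE false = refl
    endE true = sym loop
    stuck : ∀ {s z} → Reach G (λ e' → e' ≢ f) s z → s ≡ v → z ≡ v
    stuck here p = p
    stuck (step e' b' ok r) p =
      stuck r (subst (λ g → end G g (not b') ≡ v) (sym (claim ((e' , b') , p) ok))
                     (endE (not b')))
    w = end G f (not bf)
    w≡v : w ≡ v
    w≡v = stuck (tc f v w) refl
    d' : HalfAt G v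
    d' = (f , not bf) , w≡v
    td' = to d'
    d'≢a : td' ≢ ta
    d'≢a eq = f≢e (cong (λ h → proj₁ (proj₁ h)) (inj ι eq))
    d'≢b : td' ≢ tb
    d'≢b eq = f≢e (cong (λ h → proj₁ (proj₁ h)) (inj ι eq))
    d'≢k : td' ≢ k
    d'≢k eq = notlem bf (cong (λ h → proj₂ (proj₁ h)) (inj ι (trans eq (sym tc≡k))))
      where
      notlem : (x : Bool) → not x ≢ x
      notlem false ()
      notlem true ()

-- Write Gᵘ and Hᵘ for the inflations of G = H ⊕ K and of H at the apex u.
--
-- π(Gᵘ) ≥ 4: contracting the triangle turns a 3-edge-colouring of Gᵘ into one of G.  For every
-- colour z, the map moving each vertex of K along its z-coloured edge (and fixing it where that edge
-- leaves K) is an involution whose fixed points are the K-ends of the z-coloured connecting edges;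
-- so the number of these has the parity of |V(K)|, independently of z.  Hence the two connecting
-- edges of a 2-sum have equal colours and the three of a 3-sum distinct ones, and the colouring
-- descends to the snark H, which is impossible.
--
-- π(Gᵘ) ≤ 4: each of four perfect matchings covering Hᵘ meets the connecting edges in a pattern that
-- is realised by a colour class of a 3-edge-colouring of K; gluing gives four perfect matchings of
-- Gᵘ, and the classes can be chosen so that every colour, hence every edge of K, is used.

module Submission where

open import Defs
open import Algebra.Bundles using (CommutativeRing)
import Algebra.Properties.CommutativeMonoid.Sum as MonoidSum
open import Axiom.UniquenessOfIdentityProofs using (module Decidable⇒UIP)
open import Data.Bool using (Bool; true; false; not; _xor_; _∧_; if_then_else_)
import Data.Bool as Bool
import Data.Bool.Properties as BoolP
open import Data.Empty using (⊥; ⊥-elim)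
open import Data.Fin using (Fin; zero; suc; inject≤)
open import Data.Fin.Patterns using (0F; 1F; 2F)
open import Data.Fin.Properties using (_≟_; _<?_; <-cmp; <-asym; <-irrefl; inject≤-injective)
open import Data.Nat using (ℕ; suc; _≤_)
open import Data.Nat.Properties using (≤-pred)
open import Data.Product using (Σ; _×_; _,_; proj₁; proj₂)
import Data.Product.Properties as ×P
open import Data.Sum using (_⊎_; inj₁; inj₂)
import Data.Sum.Properties as ⊎P
open import Function using (_∘_; case_of_)
open import Function.Bundles using (_↔_; Inverse; Injection; mk↔ₛ′; mk⇔)
open import Function.Properties.Inverse using (↔-sym; ↔-trans; ↔⇒↣)
open import Relation.Binary.Definitions using (DecidableEquality; tri<; tri≈; tri>)
open import Relation.Binary.PropositionalEquality
open import Relation.Nullary using (¬_; Dec; yes; no; does; _×-dec_)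
open import Relation.Nullary.Decidable using (False; fromWitnessFalse; toWitnessFalse; dec-true; dec-false; does-⇔)

open Inverse using (to; from; strictlyInverseˡ; strictlyInverseʳ)

-- Sums of booleans are taken with xor, so ∑ counts modulo 2.
open MonoidSum (CommutativeRing.+-commutativeMonoid BoolP.xor-∧-commutativeRing)
  using (sum-syntax; sum-cong-≗; ∑-distrib-+; ∑-comm; sum-permute; sum-replicate-zero)


to-injective : {A B : Set} (ι : A ↔ B) {a a' : A} → to ι a ≡ to ι a' → a ≡ a'
to-injective ι = Injection.injective (↔⇒↣ ι)

from-injective : {A B : Set} (ι : A ↔ B) {b b' : B} → from ι b ≡ from ι b' → b ≡ b'
from-injective ι = to-injective (↔-sym ι)

does-true⇒ : {P : Set} (d : Dec P) → does d ≡ true → P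
does-true⇒ (yes p) _ = p

edge : {A B : Set} {P : A × B → Set} → Σ (A × B) P → A
edge h = proj₁ (proj₁ h)

side : {A B : Set} {P : A × B → Set} → Σ (A × B) P → B
side h = proj₂ (proj₁ h)

halfAt-≡ : (G : Graph) {v : V G} {h h' : HalfAt G v} → proj₁ h ≡ proj₁ h' → h ≡ h'
halfAt-≡ G {h = x , p} {.x , q} refl = cong (x ,_) (Decidable⇒UIP.≡-irrelevant (_≟V_ G) p q)

mkHalfAt↔ : (G X : Graph) {v : V G} {w : V X}
  (f : HalfAt G v → HalfAt X w) (g : HalfAt X w → HalfAt G v) →
  (∀ h → proj₁ (f (g h)) ≡ proj₁ h) → (∀ h → proj₁ (g (f h)) ≡ proj₁ h) →
  HalfAt G v ↔ HalfAt X w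
mkHalfAt↔ G X f g fg gf = mk↔ₛ′ f g (halfAt-≡ X ∘ fg) (halfAt-≡ G ∘ gf)


fin3-third : {p q r z : Fin 3} → p ≢ q → p ≢ r → q ≢ r → z ≢ p → z ≢ q → z ≡ r
fin3-third {p} {q} {r} {z} p≢q p≢r q≢r z≢p z≢q with z ≟ r
... | yes z≡r = z≡r
... | no z≢r = ⊥-elim (fin3 p q r z p≢q p≢r q≢r z≢p z≢q z≢r)

fin3-cases : {p q r : Fin 3} (z : Fin 3) → p ≢ q → p ≢ r → q ≢ r → z ≡ p ⊎ z ≡ q ⊎ z ≡ r
fin3-cases {p} {q} z p≢q p≢r q≢r with z ≟ p | z ≟ q
... | yes z≡p | _ = inj₁ z≡p
... | no _ | yes z≡q = inj₂ (inj₁ z≡q)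
... | no z≢p | no z≢q = inj₂ (inj₂ (fin3-third p≢q p≢r q≢r z≢p z≢q))

otherColours : (k : Fin 3) → Σ (Fin 3) λ a → Σ (Fin 3) λ b → a ≢ k × b ≢ k × a ≢ b
otherColours 0F = 1F , 2F , (λ ()) , (λ ()) , (λ ())
otherColours 1F = 0F , 2F , (λ ()) , (λ ()) , (λ ())
otherColours 2F = 0F , 1F , (λ ()) , (λ ()) , (λ ())

next3³ : ∀ i → next3 (next3 (next3 i)) ≡ i
next3³ 0F = refl
next3³ 1F = refl
next3³ 2F = refl

next3-injective : ∀ {i j} → next3 i ≡ next3 j → i ≡ j
next3-injective {i} {j} eq =
  trans (sym (next3³ i)) (trans (cong (next3 ∘ next3) eq) (next3³ j))

next3-adjacent : (i j : Fin 3) → i ≢ j → j ≡ next3 i ⊎ i ≡ next3 j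
next3-adjacent 0F 0F i≢j = ⊥-elim (i≢j refl)
next3-adjacent 0F 1F _ = inj₁ refl
next3-adjacent 0F 2F _ = inj₂ refl
next3-adjacent 1F 0F _ = inj₂ refl
next3-adjacent 1F 1F i≢j = ⊥-elim (i≢j refl)
next3-adjacent 1F 2F _ = inj₁ refl
next3-adjacent 2F 0F _ = inj₁ refl
next3-adjacent 2F 1F _ = inj₂ refl
next3-adjacent 2F 2F i≢j = ⊥-elim (i≢j refl)

del-≡ : {A : Set} {_≟A_ : DecidableEquality A} {z a b : A} {a≢z : False (a ≟A z)} {b≢z : False (b ≟A z)} →
  a ≡ b → _≡_ {A = Del _≟A_ z} (a , a≢z) (b , b≢z)
del-≡ refl = cong (_ ,_) (False-irr _ _)

true≢false-at : {A : Set} {a a' : A} → (a , true) ≢ (a' , false)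
true≢false-at eq with cong proj₂ eq
... | ()

true≢false : true ≢ false
true≢false ()

Matched : (G : Graph) → (E G → Bool) → V G → Set
Matched G M v = Σ (HalfAt G v) λ h → M (edge h) ≡ true

UniqueMatch : (G : Graph) → (E G → Bool) → V G → Set
UniqueMatch G M v = Matched G M v × (∀ (m m' : Matched G M v) → proj₁ m ≡ proj₁ m')

module _ (G : Graph) (M : E G → Bool) where

  unique⇒perfectMatching : (∀ v → UniqueMatch G M v) → PerfectMatching G M
  unique⇒perfectMatching unique v =
    mk↔ₛ′ (λ _ → zero) (λ _ → proj₁ (unique v)) (λ { zero → refl ; (suc ()) })
          (λ m → matched-≡ (proj₂ (unique v) (proj₁ (unique v)) m))
    where
    matched-≡ : {m m' : Matched G M v} → proj₁ m ≡ proj₁ m' → m ≡ m'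
    matched-≡ {h , p} {.h , q} refl = cong (h ,_) (Decidable⇒UIP.≡-irrelevant Bool._≟_ p q)

  perfectMatching⇒unique : PerfectMatching G M → ∀ v → UniqueMatch G M v
  perfectMatching⇒unique pm v =
    from (pm v) zero , λ m m' → cong proj₁ (to-injective (pm v) (fin1 (to (pm v) m) (to (pm v) m')))
    where
    fin1 : (i j : Fin 1) → i ≡ j
    fin1 zero zero = refl

uniqueMatch-transport : (G X : Graph) {v : V G} {w : V X} (ψ : HalfAt G v ↔ HalfAt X w)
  {MG : E G → Bool} {MX : E X → Bool} →
  (∀ h → MG (edge h) ≡ MX (edge (to ψ h))) → UniqueMatch X MX w → UniqueMatch G MG v
uniqueMatch-transport G X ψ {MG} {MX} pres ((hX , mX) , unique) =
  (from ψ hX , trans (pres (from ψ hX)) (trans (cong (λ h → MX (edge h)) (strictlyInverseˡ ψ hX)) mX)) ,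
  λ (h , m) (h' , m') →
    to-injective ψ (unique (to ψ h , trans (sym (pres h)) m) (to ψ h' , trans (sym (pres h')) m'))

Proper : (G : Graph) → (E G → Fin 3) → Set
Proper G c = ∀ (h h' : E G × Bool) → h ≢ h' →
  end G (proj₁ h) (proj₂ h) ≡ end G (proj₁ h') (proj₂ h') → c (proj₁ h) ≢ c (proj₁ h')

module _ (G : Graph) {c : E G → Fin 3} (proper : Proper G c) where

  proper-halfAt-injective : {v : V G} (h h' : HalfAt G v) → c (edge h) ≡ c (edge h') → h ≡ h'
  proper-halfAt-injective h h' same with ×P.≡-dec (_≟E_ G) Bool._≟_ (proj₁ h) (proj₁ h')
  ... | yes eq = halfAt-≡ G eq
  ... | no neq = ⊥-elim (proper (proj₁ h) (proj₁ h') neq (trans (proj₂ h) (sym (proj₂ h'))) same)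

  colour-occurs : {v : V G} → HalfAt G v ↔ Fin 3 → (z : Fin 3) → Σ (HalfAt G v) λ h → c (edge h) ≡ z
  colour-occurs ι z with fin3-cases z (distinct (λ ())) (distinct (λ ())) (distinct (λ ()))
    where
    distinct : {i j : Fin 3} → i ≢ j → c (edge (from ι i)) ≢ c (edge (from ι j))
    distinct i≢j same = i≢j (from-injective ι (proper-halfAt-injective _ _ same))
  ... | inj₁ z≡ = from ι 0F , sym z≡
  ... | inj₂ (inj₁ z≡) = from ι 1F , sym z≡
  ... | inj₂ (inj₂ z≡) = from ι 2F , sym z≡

colourClass : {G : Graph} → (E G → Fin 3) → Fin 3 → E G → Bool
colourClass c z e = does (c e ≟ z)

colourClass-unique : (G : Graph) {c : E G → Fin 3} → Proper G c → {v : V G} → HalfAt G v ↔ Fin 3 →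
  (z : Fin 3) → UniqueMatch G (colourClass {G} c z) v
colourClass-unique G {c} proper ι z with colour-occurs G proper ι z
... | h , cz = (h , dec-true (c (edge h) ≟ z) cz) , λ (h₁ , m₁) (h₂ , m₂) →
  proper-halfAt-injective G proper h₁ h₂ (trans (does-true⇒ (_ ≟ z) m₁) (sym (does-true⇒ (_ ≟ z) m₂)))

cover⇒colourable : (G : Graph) {j : ℕ} → j ≤ 3 → CoverBy G j → ThreeEdgeColourable G
cover⇒colourable G j≤3 (Ms , perfect , covered) = colour , proper
  where
  colour : E G → Fin 3
  colour e = inject≤ (proj₁ (covered e)) j≤3
  proper : Proper G colour
  proper (e , b) (e' , b') neq ends same = neq (cong proj₁ (proj₂ unique at-e at-e′))
    where
    i = proj₁ (covered e)
    i≡i' : i ≡ proj₁ (covered e')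
    i≡i' = inject≤-injective j≤3 j≤3 _ _ same
    unique = perfectMatching⇒unique G (Ms i) (perfect i) (end G e b)
    at-e at-e′ : Matched G (Ms i) (end G e b)
    at-e = ((e , b) , refl) , proj₂ (covered e)
    at-e′ = ((e' , b') , sym ends) , subst (λ k → Ms k e' ≡ true) (sym i≡i') (proj₂ (covered e'))

pmIndex≡4 : (G : Graph) → CoverBy G 4 → ¬ ThreeEdgeColourable G → PMIndexIs G 4
pmIndex≡4 G cover uncolourable =
  cover , λ j j<4 cover′ → uncolourable (cover⇒colourable G (≤-pred j<4) cover′)

loopless-ends : (G : Graph) → Loopless G → ∀ e b → end G e (not b) ≢ end G e b
loopless-ends G loopless e false eq = loopless e (sym eq)
loopless-ends G loopless e true eq = loopless e eq

otherHalves : (G : Graph) {v : V G} → HalfAt G v ↔ Fin 3 → (h : HalfAt G v) →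
  Σ (HalfAt G v) λ h₁ → Σ (HalfAt G v) λ h₂ → h₁ ≢ h × h₂ ≢ h × h₁ ≢ h₂
otherHalves G ι h with otherColours (to ι h)
... | i₁ , i₂ , i₁≢ , i₂≢ , i₁≢i₂ =
  from ι i₁ , from ι i₂ ,
  (λ eq → i₁≢ (trans (sym (strictlyInverseˡ ι i₁)) (cong (to ι) eq))) ,
  (λ eq → i₂≢ (trans (sym (strictlyInverseˡ ι i₂)) (cong (to ι) eq))) ,
  (λ eq → i₁≢i₂ (from-injective ι eq))

endpoint-avoiding : (G : Graph) → Loopless G → (e : E G) (u : V G) → Σ Bool λ b → end G e b ≢ u
endpoint-avoiding G loopless e u with _≟V_ G (end G e false) u
... | yes at-u = true , λ at-u′ → loopless e (trans at-u (sym at-u′))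
... | no ≢u = false , ≢u

trichotomy-xor : ∀ {n} (i j : Fin n) → does (j ≟ i) xor (does (i <? j) xor does (j <? i)) ≡ true
trichotomy-xor i j with <-cmp i j
... | tri< i<j i≢j _
  rewrite dec-false (j ≟ i) (i≢j ∘ sym) | dec-true (i <? j) i<j | dec-false (j <? i) (<-asym i<j) = refl
... | tri≈ _ refl _ rewrite dec-true (i ≟ i) refl | dec-false (i <? i) (<-irrefl refl) = refl
... | tri> _ i≢j j<i
  rewrite dec-false (j ≟ i) (i≢j ∘ sym) | dec-false (i <? j) (<-asym j<i) | dec-true (j <? i) j<i = refl

-- The pairs i < τ i and τ i < i are exchanged by τ, so they cancel in the sum;
-- what remains are the fixed points.
involution-fixedPoints-parity : ∀ {n} (τ : Fin n → Fin n) → (∀ i → τ (τ i) ≡ i) →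
  ∑[ i < n ] does (τ i ≟ i) ≡ ∑[ i < n ] true
involution-fixedPoints-parity {n} τ involutive = sym (begin
  ∑[ i < n ] true                                   ≡⟨ sum-cong-≗ (λ i → sym (trichotomy-xor i (τ i))) ⟩
  ∑[ i < n ] (fixed i xor (below i xor above i))    ≡⟨ ∑-distrib-+ fixed _ ⟩
  ∑[ i < n ] fixed i xor ∑[ i < n ] (below i xor above i)
    ≡⟨ cong (∑[ i < n ] fixed i xor_) (∑-distrib-+ below above) ⟩
  ∑[ i < n ] fixed i xor (∑[ i < n ] below i xor ∑[ i < n ] above i)
    ≡⟨ cong (λ s → ∑[ i < n ] fixed i xor (∑[ i < n ] below i xor s)) above≡below ⟩
  ∑[ i < n ] fixed i xor (∑[ i < n ] below i xor ∑[ i < n ] below i)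
    ≡⟨ cong (∑[ i < n ] fixed i xor_) (BoolP.xor-same (∑[ i < n ] below i)) ⟩
  ∑[ i < n ] fixed i xor false                     ≡⟨ BoolP.xor-identityʳ _ ⟩
  ∑[ i < n ] fixed i                               ∎)
  where
  open ≡-Reasoning
  fixed below above : Fin n → Bool
  fixed i = does (τ i ≟ i)
  below i = does (i <? τ i)
  above i = does (τ i <? i)
  above≡below : ∑[ i < n ] above i ≡ ∑[ i < n ] below i
  above≡below = trans (sum-permute above (mk↔ₛ′ τ τ involutive involutive))
                      (sum-cong-≗ (λ i → cong (λ k → does (k <? τ i)) (involutive i)))

∑-indicator : ∀ {m} (j : Fin m) → ∑[ i < m ] does (i ≟ j) ≡ true
∑-indicator {suc m} zero = cong (true xor_) (sum-replicate-zero m)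
∑-indicator {suc m} (suc j) = ∑-indicator j

∑-false : ∀ {m} {f : Fin m → Bool} → (∀ i → f i ≡ false) → ∑[ i < m ] f i ≡ false
∑-false {m} f≡false = trans (sum-cong-≗ f≡false) (sum-replicate-zero m)

module Parity {T : Set} (_≟T_ : DecidableEquality T) {n : ℕ} (enum : T ↔ Fin n) where

  parity : (T → Bool) → Bool
  parity f = ∑[ i < n ] f (from enum i)

  parity-cong : {f g : T → Bool} → (∀ k → f k ≡ g k) → parity f ≡ parity g
  parity-cong f≗g = sum-cong-≗ (f≗g ∘ from enum)

  parity-xor : (f g : T → Bool) → parity (λ k → f k xor g k) ≡ parity f xor parity g
  parity-xor f g = ∑-distrib-+ (f ∘ from enum) (g ∘ from enum)

  parity-false : parity (λ _ → false) ≡ false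
  parity-false = ∑-false {n} (λ _ → refl)

  parity-∑ : ∀ {m} (f : Fin m → T → Bool) → parity (λ k → ∑[ t < m ] f t k) ≡ ∑[ t < m ] parity (f t)
  parity-∑ f = ∑-comm (λ i t → f t (from enum i))

  parity-∧ : (b : Bool) (f : T → Bool) → parity (λ k → b ∧ f k) ≡ b ∧ parity f
  parity-∧ true f = refl
  parity-∧ false f = parity-false

  parity-singleton : (a : T) → parity (λ k → does (k ≟T a)) ≡ true
  parity-singleton a = trans (sum-cong-≗ same) (∑-indicator (to enum a))
    where
    same : ∀ i → does (from enum i ≟T a) ≡ does (i ≟ to enum a)
    same i = does-⇔ (mk⇔ (λ eq → trans (sym (strictlyInverseˡ enum i)) (cong (to enum) eq))
                          (λ eq → trans (cong (from enum) eq) (strictlyInverseʳ enum a)))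
                     (from enum i ≟T a) (i ≟ to enum a)

  involution-parity : (σ : T → T) → (∀ k → σ (σ k) ≡ k) →
    parity (λ k → does (σ k ≟T k)) ≡ parity (λ _ → true)
  involution-parity σ involutive = trans (sum-cong-≗ same) (involution-fixedPoints-parity τ τ-involutive)
    where
    τ : Fin n → Fin n
    τ i = to enum (σ (from enum i))
    τ-involutive : ∀ i → τ (τ i) ≡ i
    τ-involutive i = trans (cong (to enum ∘ σ) (strictlyInverseʳ enum _))
                           (trans (cong (to enum) (involutive _)) (strictlyInverseˡ enum i))
    same : ∀ i → does (σ (from enum i) ≟T from enum i) ≡ does (τ i ≟ i)
    same i = does-⇔ (mk⇔ (λ eq → trans (cong (to enum) eq) (strictlyInverseˡ enum i))
                          (λ eq → trans (sym (strictlyInverseʳ enum _)) (cong (from enum) eq)))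
                     (σ (from enum i) ≟T from enum i) (τ i ≟ i)

-- If two of the a t coincide, the count of colour z is the indicator of the third one.
balanced-colours-injective : (a : Fin 3 → Fin 3) →
  (∀ z z' → ∑[ t < 3 ] does (a t ≟ z) ≡ ∑[ t < 3 ] does (a t ≟ z')) →
  ∀ t t' → a t ≡ a t' → t ≡ t'
balanced-colours-injective a balanced t t' same with t ≟ t'
... | yes t≡t' = t≡t'
... | no t≢t' = ⊥-elim (single (collapse t t' t≢t' same))
  where
  count : Fin 3 → Bool
  count z = ∑[ t < 3 ] does (a t ≟ z)

  single : Σ (Fin 3) (λ k → ∀ z → count z ≡ does (a k ≟ z)) → ⊥
  single (k , count≡) = true≢false (begin
    true               ≡⟨ dec-true (a k ≟ a k) refl ⟨
    does (a k ≟ a k)   ≡⟨ count≡ (a k) ⟨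
    count (a k)        ≡⟨ balanced (a k) r ⟩
    count r            ≡⟨ count≡ r ⟩
    does (a k ≟ r)     ≡⟨ dec-false (a k ≟ r) (proj₁ (proj₂ (proj₂ (otherColours (a k)))) ∘ sym) ⟩
    false              ∎)
    where
    open ≡-Reasoning
    r = proj₁ (otherColours (a k))

  xxy : ∀ p q → p xor (p xor (q xor false)) ≡ q
  xxy false false = refl
  xxy false true = refl
  xxy true false = refl
  xxy true true = refl

  xyx : ∀ p q → p xor (q xor (p xor false)) ≡ q
  xyx false false = refl
  xyx false true = refl
  xyx true false = refl
  xyx true true = refl

  xyy : ∀ p q → p xor (q xor (q xor false)) ≡ p
  xyy false false = refl
  xyy false true = refl
  xyy true false = refl
  xyy true true = refl

  collapse : ∀ i j → i ≢ j → a i ≡ a j → Σ (Fin 3) λ k → ∀ z → count z ≡ does (a k ≟ z)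
  collapse 0F 1F _ a₀≡a₁ = 2F , λ z →
    trans (cong (λ c → does (a 0F ≟ z) xor (does (c ≟ z) xor (does (a 2F ≟ z) xor false))) (sym a₀≡a₁))
          (xxy (does (a 0F ≟ z)) (does (a 2F ≟ z)))
  collapse 0F 2F _ a₀≡a₂ = 1F , λ z →
    trans (cong (λ c → does (a 0F ≟ z) xor (does (a 1F ≟ z) xor (does (c ≟ z) xor false))) (sym a₀≡a₂))
          (xyx (does (a 0F ≟ z)) (does (a 1F ≟ z)))
  collapse 1F 2F _ a₁≡a₂ = 0F , λ z →
    trans (cong (λ c → does (a 0F ≟ z) xor (does (a 1F ≟ z) xor (does (c ≟ z) xor false))) (sym a₁≡a₂))
          (xyy (does (a 0F ≟ z)) (does (a 1F ≟ z)))
  collapse 1F 0F i≢j aᵢ≡aⱼ = collapse 0F 1F (i≢j ∘ sym) (sym aᵢ≡aⱼ)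
  collapse 2F 0F i≢j aᵢ≡aⱼ = collapse 0F 2F (i≢j ∘ sym) (sym aᵢ≡aⱼ)
  collapse 2F 1F i≢j aᵢ≡aⱼ = collapse 1F 2F (i≢j ∘ sym) (sym aᵢ≡aⱼ)
  collapse 0F 0F i≢j _ = ⊥-elim (i≢j refl)
  collapse 1F 1F i≢j _ = ⊥-elim (i≢j refl)
  collapse 2F 2F i≢j _ = ⊥-elim (i≢j refl)

module Inflation (X : Graph) (w : V X) (ι : HalfAt X w ↔ Fin 3) where

  Xʷ : Graph
  Xʷ = inflate X w ι

  end-outside⇒ : ∀ e b {v} (v≢w : False (_≟V_ X v w)) →
    end Xʷ (inj₁ e) b ≡ inj₁ (v , v≢w) → end X e b ≡ v
  end-outside⇒ e b v≢w eq with _≟V_ X (end X e b) w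
  end-outside⇒ e b v≢w refl | no _ = refl

  end-outside : ∀ e b {v} (v≢w : False (_≟V_ X v w)) →
    end X e b ≡ v → end Xʷ (inj₁ e) b ≡ inj₁ (v , v≢w)
  end-outside e b v≢w eq with _≟V_ X (end X e b) w
  ... | yes at-w = ⊥-elim (toWitnessFalse v≢w (trans (sym eq) at-w))
  ... | no _ = cong inj₁ (del-≡ {_≟A_ = _≟V_ X} eq)

  end-triangle⇒ : ∀ e b i → end Xʷ (inj₁ e) b ≡ inj₂ i →
    Σ (end X e b ≡ w) λ p → to ι ((e , b) , p) ≡ i
  end-triangle⇒ e b i eq with _≟V_ X (end X e b) w
  end-triangle⇒ e b i refl | yes at-w = at-w , refl

  end-triangle : ∀ e b (p : end X e b ≡ w) → end Xʷ (inj₁ e) b ≡ inj₂ (to ι ((e , b) , p))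
  end-triangle e b p with _≟V_ X (end X e b) w
  ... | yes p′ = cong (λ q → inj₂ (to ι ((e , b) , q))) (Decidable⇒UIP.≡-irrelevant (_≟V_ X) p′ p)
  ... | no ¬p = ⊥-elim (¬p p)

  halfAt-outside↔ : (v : V X) (v≢w : False (_≟V_ X v w)) → HalfAt Xʷ (inj₁ (v , v≢w)) ↔ HalfAt X v
  halfAt-outside↔ v v≢w = mkHalfAt↔ Xʷ X f g (λ _ → refl) gf
    where
    f : HalfAt Xʷ (inj₁ (v , v≢w)) → HalfAt X v
    f ((inj₁ e , b) , p) = (e , b) , end-outside⇒ e b v≢w p
    f ((inj₂ _ , false) , ())
    f ((inj₂ _ , true) , ())
    g : HalfAt X v → HalfAt Xʷ (inj₁ (v , v≢w))
    g ((e , b) , p) = (inj₁ e , b) , end-outside e b v≢w p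
    gf : ∀ h → proj₁ (g (f h)) ≡ proj₁ h
    gf ((inj₁ e , b) , p) = refl
    gf ((inj₂ _ , false) , ())
    gf ((inj₂ _ , true) , ())

  edge-outside : ∀ {v} {v≢w : False (_≟V_ X v w)} (h : HalfAt Xʷ (inj₁ (v , v≢w))) →
    edge h ≡ inj₁ (edge (to (halfAt-outside↔ v v≢w) h))
  edge-outside ((inj₁ _ , _) , _) = refl
  edge-outside ((inj₂ _ , false) , ())
  edge-outside ((inj₂ _ , true) , ())

  module _ {c : E Xʷ → Fin 3} (proper : Proper Xʷ c) where

    private
      colour : Fin 3 → Fin 3
      colour i = c (inj₂ i)

      colour-adjacent : ∀ i → colour i ≢ colour (next3 i)
      colour-adjacent i = proper (inj₂ i , true) (inj₂ (next3 i) , false) true≢false-at refl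

      colour-injective : ∀ {i j} → colour i ≡ colour j → i ≡ j
      colour-injective {i} {j} same with i ≟ j
      ... | yes i≡j = i≡j
      ... | no i≢j with next3-adjacent i j i≢j
      ... | inj₁ refl = ⊥-elim (colour-adjacent i same)
      ... | inj₂ refl = ⊥-elim (colour-adjacent j (sym same))

    -- An edge entering triangle vertex i avoids the colours of the two triangle edges at i,
    -- so it takes the colour of the opposite triangle edge.
    colour-entering : ∀ e b i → end Xʷ (inj₁ e) b ≡ inj₂ i → c (inj₁ e) ≡ colour (next3 i)
    colour-entering e b i p = fin3-third
      (λ same → colour-adjacent (next3 (next3 i)) (trans (sym same) (cong colour (sym (next3³ i)))))
      (colour-adjacent i)
      (λ same → colour-adjacent (next3 i) (sym same))
      (proper (inj₁ e , b) (inj₂ i , false) (λ ()) p)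
      (proper (inj₁ e , b) (inj₂ (next3 (next3 i)) , true) (λ ()) (trans p (cong inj₂ (sym (next3³ i)))))

    proper-contract : Proper X (c ∘ inj₁)
    proper-contract (e , b) (e' , b') neq ends same with _≟V_ X (end X e b) w
    ... | no ¬w = proper (inj₁ e , b) (inj₁ e' , b')
                    (λ eq → neq (cong₂ _,_ (⊎P.inj₁-injective (cong proj₁ eq)) (cong proj₂ eq)))
                    (trans (end-outside e b (fromWitnessFalse ¬w) refl)
                           (sym (end-outside e' b' (fromWitnessFalse ¬w) (sym ends)))) same
    ... | yes at-w = neq (cong proj₁ (to-injective ι (next3-injective (colour-injective
           (trans (sym (colour-entering e b _ (end-triangle e b at-w)))
           (trans same (colour-entering e' b' _ (end-triangle e' b' (trans (sym ends) at-w)))))))))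

inflate-colourable⇒colourable : (X : Graph) (w : V X) (ι : HalfAt X w ↔ Fin 3) →
  ThreeEdgeColourable (inflate X w ι) → ThreeEdgeColourable X
inflate-colourable⇒colourable X w ι (c , proper) = c ∘ inj₁ , Inflation.proper-contract X w ι proper

-- ιY labels the triangle of Yʷ through ψ, so that the two triangles correspond vertex by vertex.
module InflationTransport (X Y : Graph) {w : V X} {w' : V Y} (ψ : HalfAt X w ↔ HalfAt Y w')
                          (ιX : HalfAt X w ↔ Fin 3) where

  ιY : HalfAt Y w' ↔ Fin 3
  ιY = ↔-trans (↔-sym ψ) ιX

  module IX = Inflation X w ιX
  module IY = Inflation Y w' ιY

  triangle-halfAt↔ : (i : Fin 3) → HalfAt IX.Xʷ (inj₂ i) ↔ HalfAt IY.Xʷ (inj₂ i)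
  triangle-halfAt↔ i = mkHalfAt↔ IX.Xʷ IY.Xʷ f g fg gf
    where
    f : HalfAt IX.Xʷ (inj₂ i) → HalfAt IY.Xʷ (inj₂ i)
    f ((inj₁ e , b) , p) = (inj₁ (edge h) , side h) ,
      trans (IY.end-triangle (edge h) (side h) (proj₂ h))
            (cong inj₂ (trans (cong (to ιX) (strictlyInverseʳ ψ _)) (proj₂ (IX.end-triangle⇒ e b i p))))
      where h = to ψ ((e , b) , proj₁ (IX.end-triangle⇒ e b i p))
    f ((inj₂ k , false) , p) = (inj₂ k , false) , cong inj₂ (⊎P.inj₂-injective p)
    f ((inj₂ k , true) , p) = (inj₂ k , true) , cong inj₂ (⊎P.inj₂-injective p)
    g : HalfAt IY.Xʷ (inj₂ i) → HalfAt IX.Xʷ (inj₂ i)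
    g ((inj₁ e , b) , p) = (inj₁ (edge h) , side h) ,
      trans (IX.end-triangle (edge h) (side h) (proj₂ h)) (cong inj₂ (proj₂ (IY.end-triangle⇒ e b i p)))
      where h = from ψ ((e , b) , proj₁ (IY.end-triangle⇒ e b i p))
    g ((inj₂ k , false) , p) = (inj₂ k , false) , cong inj₂ (⊎P.inj₂-injective p)
    g ((inj₂ k , true) , p) = (inj₂ k , true) , cong inj₂ (⊎P.inj₂-injective p)
    fg : ∀ h → proj₁ (f (g h)) ≡ proj₁ h
    fg ((inj₁ e , b) , p) = cong (λ h → inj₁ (edge h) , side h)
                                 (trans (cong (to ψ) (halfAt-≡ X refl)) (strictlyInverseˡ ψ _))
    fg ((inj₂ k , false) , p) = refl
    fg ((inj₂ k , true) , p) = refl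
    gf : ∀ h → proj₁ (g (f h)) ≡ proj₁ h
    gf ((inj₁ e , b) , p) = cong (λ h → inj₁ (edge h) , side h)
                                 (trans (cong (from ψ) (halfAt-≡ Y refl)) (strictlyInverseʳ ψ _))
    gf ((inj₂ k , false) , p) = refl
    gf ((inj₂ k , true) , p) = refl

xor-cancelʳ : ∀ b s → (b xor s) xor s ≡ b
xor-cancelʳ b s = trans (BoolP.xor-assoc b s s) (trans (cong (b xor_) (BoolP.xor-same s)) (BoolP.xor-identityʳ b))

module TwoSum (H K : Graph) (eH : E H) (eK : E K) (s : Bool) where

  G : Graph
  G = twoSum H K eH eK s

  connector : Bool → E G
  connector j = inj₂ (inj₂ j)

  halfAtH↔ : (v : V H) → HalfAt G (inj₁ v) ↔ HalfAt H v
  halfAtH↔ v = mkHalfAt↔ G H f g fg gf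
    where
    f : HalfAt G (inj₁ v) → HalfAt H v
    f ((inj₁ (e , _) , b) , p) = (e , b) , ⊎P.inj₁-injective p
    f ((inj₂ (inj₂ j) , false) , p) = (eH , j) , ⊎P.inj₁-injective p
    f ((inj₂ (inj₁ _) , b) , ())
    f ((inj₂ (inj₂ j) , true) , ())
    g′ : ∀ e b → end H e b ≡ v → Dec (e ≡ eH) → HalfAt G (inj₁ v)
    g′ e b p (yes refl) = (connector b , false) , cong inj₁ p
    g′ e b p (no e≢eH) = (inj₁ (e , fromWitnessFalse e≢eH) , b) , cong inj₁ p
    g : HalfAt H v → HalfAt G (inj₁ v)
    g ((e , b) , p) = g′ e b p (_≟E_ H e eH)
    fg : ∀ h → proj₁ (f (g h)) ≡ proj₁ h
    fg ((e , b) , p) with _≟E_ H e eH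
    ... | yes refl = refl
    ... | no _ = refl
    g′-kept : ∀ e b p d (e≢eH : False (_≟E_ H e eH)) → proj₁ (g′ e b p d) ≡ (inj₁ (e , e≢eH) , b)
    g′-kept e b p (yes refl) e≢eH = ⊥-elim (toWitnessFalse e≢eH refl)
    g′-kept e b p (no _) e≢eH = cong (λ q → inj₁ (e , q) , b) (False-irr _ _)
    gf : ∀ h → proj₁ (g (f h)) ≡ proj₁ h
    gf ((inj₁ (e , e≢eH) , b) , p) = g′-kept e b _ (_≟E_ H e eH) e≢eH
    gf ((inj₂ (inj₂ j) , false) , p) with _≟E_ H eH eH
    ... | yes refl = refl
    ... | no ≢ = ⊥-elim (≢ refl)

  halfAtK↔ : (k : V K) → HalfAt G (inj₂ k) ↔ HalfAt K k
  halfAtK↔ k = mkHalfAt↔ G K f g fg gf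
    where
    f : HalfAt G (inj₂ k) → HalfAt K k
    f ((inj₂ (inj₁ (e , _)) , b) , p) = (e , b) , ⊎P.inj₂-injective p
    f ((inj₂ (inj₂ j) , true) , p) = (eK , j xor s) , ⊎P.inj₂-injective p
    f ((inj₁ _ , b) , ())
    f ((inj₂ (inj₂ j) , false) , ())
    g′ : ∀ e b → end K e b ≡ k → Dec (e ≡ eK) → HalfAt G (inj₂ k)
    g′ e b p (yes refl) = (connector (b xor s) , true) , cong inj₂ (trans (cong (end K eK) (xor-cancelʳ b s)) p)
    g′ e b p (no e≢eK) = (inj₂ (inj₁ (e , fromWitnessFalse e≢eK)) , b) , cong inj₂ p
    g : HalfAt K k → HalfAt G (inj₂ k)
    g ((e , b) , p) = g′ e b p (_≟E_ K e eK)
    fg : ∀ h → proj₁ (f (g h)) ≡ proj₁ h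
    fg ((e , b) , p) with _≟E_ K e eK
    ... | yes refl = cong (eK ,_) (xor-cancelʳ b s)
    ... | no _ = refl
    g′-kept : ∀ e b p d (e≢eK : False (_≟E_ K e eK)) →
      proj₁ (g′ e b p d) ≡ (inj₂ (inj₁ (e , e≢eK)) , b)
    g′-kept e b p (yes refl) e≢eK = ⊥-elim (toWitnessFalse e≢eK refl)
    g′-kept e b p (no _) e≢eK = cong (λ q → inj₂ (inj₁ (e , q)) , b) (False-irr _ _)
    gf : ∀ h → proj₁ (g (f h)) ≡ proj₁ h
    gf ((inj₂ (inj₁ (e , e≢eK)) , b) , p) = g′-kept e b _ (_≟E_ K e eK) e≢eK
    gf ((inj₂ (inj₂ j) , true) , p) with _≟E_ K eK eK
    ... | yes refl = cong (λ j′ → connector j′ , true) (xor-cancelʳ j s)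
    ... | no ≢ = ⊥-elim (≢ refl)

  -- For each colour z, σ z moves a vertex of K along its z-coloured edge, and stays put where that
  -- edge is a connector.  Its fixed points are the K-ends of the z-coloured connectors, so their
  -- number has the parity of |V K| for every z.
  module Restriction {n : ℕ} (enumK : V K ↔ Fin n) (cubicK : Cubic K) (looplessK : Loopless K)
                     {c : E G → Fin 3} (proper : Proper G c) where
    open Parity (_≟V_ K) enumK

    halfOfColour : (z : Fin 3) (k : V K) → Σ (HalfAt G (inj₂ k)) λ h → c (edge h) ≡ z
    halfOfColour z k = colour-occurs G proper (↔-trans (halfAtK↔ k) (cubicK k)) z

    across : (k : V K) → HalfAt G (inj₂ k) → V K
    across k ((inj₂ (inj₁ (e , _)) , b) , _) = end K e (not b)
    across k ((inj₂ (inj₂ _) , true) , _) = k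
    across k ((inj₁ _ , _) , ())
    across k ((inj₂ (inj₂ _) , false) , ())

    σ : Fin 3 → V K → V K
    σ z k = across k (proj₁ (halfOfColour z k))

    σ-across : ∀ {z k} (h : HalfAt G (inj₂ k)) → c (edge h) ≡ z → σ z k ≡ across k h
    σ-across h cz =
      cong (across _) (proper-halfAt-injective G proper _ h (trans (proj₂ (halfOfColour _ _)) (sym cz)))

    σ-back : ∀ {z k} (h : HalfAt G (inj₂ k)) → c (edge h) ≡ z → σ z (across k h) ≡ k
    σ-back ((inj₂ (inj₁ (e , e≢eK)) , b) , p) cz =
      trans (σ-across ((inj₂ (inj₁ (e , e≢eK)) , not b) , refl) cz)
            (trans (cong (end K e) (BoolP.not-involutive b)) (⊎P.inj₂-injective p))
    σ-back h@((inj₂ (inj₂ _) , true) , _) cz = σ-across h cz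
    σ-back ((inj₁ _ , _) , ()) cz
    σ-back ((inj₂ (inj₂ _) , false) , ()) cz

    σ-involutive : ∀ z k → σ z (σ z k) ≡ k
    σ-involutive z k = σ-back (proj₁ (halfOfColour z k)) (proj₂ (halfOfColour z k))

    endK : Bool → V K
    endK j = end K eK (j xor s)

    stays⇒connector : ∀ {z k} (h : HalfAt G (inj₂ k)) → c (edge h) ≡ z → across k h ≡ k →
      Σ Bool λ j → c (connector j) ≡ z × k ≡ endK j
    stays⇒connector ((inj₂ (inj₁ (e , _)) , b) , p) cz stays =
      ⊥-elim (loopless-ends K looplessK e b (trans stays (sym (⊎P.inj₂-injective p))))
    stays⇒connector ((inj₂ (inj₂ j) , true) , p) cz stays = j , cz , sym (⊎P.inj₂-injective p)
    stays⇒connector ((inj₁ _ , _) , ()) cz stays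
    stays⇒connector ((inj₂ (inj₂ _) , false) , ()) cz stays

    fixed⇒connector : ∀ {z k} → σ z k ≡ k → Σ Bool λ j → c (connector j) ≡ z × k ≡ endK j
    fixed⇒connector {z} {k} = stays⇒connector (proj₁ (halfOfColour z k)) (proj₂ (halfOfColour z k))

    connector⇒fixed : ∀ {z} j → c (connector j) ≡ z → σ z (endK j) ≡ endK j
    connector⇒fixed j cz = σ-across ((connector j , true) , refl) cz

    fixedPoints : Fin 3 → V K → Bool
    fixedPoints z k = does (_≟V_ K (σ z k) k)

    connectors-sameColour : c (connector true) ≡ c (connector false)
    connectors-sameColour with c (connector false) ≟ c (connector true)
    ... | yes same = sym same
    ... | no differ = ⊥-elim (true≢false (begin
      true                                        ≡⟨ parity-singleton (endK false) ⟨
      parity (λ k → does (_≟V_ K k (endK false))) ≡⟨ parity-cong fixed₀ ⟨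
      parity (fixedPoints c₀)                     ≡⟨ involution-parity (σ c₀) (σ-involutive c₀) ⟩
      parity (λ _ → true)                         ≡⟨ involution-parity (σ r) (σ-involutive r) ⟨
      parity (fixedPoints r)                      ≡⟨ parity-cong fixedᵣ ⟩
      parity (λ _ → false)                        ≡⟨ parity-false ⟩
      false                                       ∎))
      where
      open ≡-Reasoning
      c₀ c₁ r : Fin 3
      c₀ = c (connector false)
      c₁ = c (connector true)
      r = proj₁ (third c₀ c₁ differ)
      fixed₀ : ∀ k → fixedPoints c₀ k ≡ does (_≟V_ K k (endK false))
      fixed₀ k = does-⇔ (mk⇔ fixed⇒endK (λ { refl → connector⇒fixed false refl }))
                        (_≟V_ K (σ c₀ k) k) (_≟V_ K k (endK false))
        where
        fixed⇒endK : σ c₀ k ≡ k → k ≡ endK false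
        fixed⇒endK stays with fixed⇒connector stays
        ... | false , _ , k≡ = k≡
        ... | true , c₁≡c₀ , _ = ⊥-elim (differ (sym c₁≡c₀))
      fixedᵣ : ∀ k → fixedPoints r k ≡ false
      fixedᵣ k = dec-false (_≟V_ K (σ r k) k) λ stays → case fixed⇒connector stays of λ where
        (false , c₀≡r , _) → proj₁ (proj₂ (third c₀ c₁ differ)) (sym c₀≡r)
        (true , c₁≡r , _) → proj₂ (proj₂ (third c₀ c₁ differ)) (sym c₁≡r)

    colourH : E H → Fin 3
    colourH e with _≟E_ H e eH
    ... | yes _ = c (connector false)
    ... | no e≢eH = c (inj₁ (e , fromWitnessFalse e≢eH))

    colourH-at : ∀ {v} (h : HalfAt H v) → c (edge (from (halfAtH↔ v) h)) ≡ colourH (edge h)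
    colourH-at ((e , b) , p) with _≟E_ H e eH
    colourH-at ((e , false) , p) | yes refl = refl
    colourH-at ((e , true) , p) | yes refl = connectors-sameColour
    ... | no _ = refl

    proper-restrictH : Proper H colourH
    proper-restrictH (e , b) (e' , b') neq ends same = neq (cong proj₁ (from-injective (halfAtH↔ v)
      (proper-halfAt-injective G proper (from (halfAtH↔ v) h) (from (halfAtH↔ v) h')
        (trans (colourH-at h) (trans same (sym (colourH-at h')))))))
      where
      v = end H e b
      h h' : HalfAt H v
      h = (e , b) , refl
      h' = (e' , b') , sym ends

twoSum-colourable⇒colourable : (H K : Graph) (eH : E H) (eK : E K) (s : Bool) →
  Σ ℕ (λ n → V K ↔ Fin n) → Cubic K → Loopless K →
  ThreeEdgeColourable (twoSum H K eH eK s) → ThreeEdgeColourable H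
twoSum-colourable⇒colourable H K eH eK s (_ , enumK) cubicK looplessK (c , proper) =
  colourH , proper-restrictH
  where open TwoSum.Restriction H K eH eK s enumK cubicK looplessK proper

-- A covering of Hᵘ by four perfect matchings is completed on the K side by colour classes of K:
-- the class of colour(eK) where the matching contains eH, and one of the two other classes where it
-- does not.  Both other classes are used, because the two edges at an end a ≠ u of eH other than eH
-- lie in distinct matchings avoiding eH.
module TwoSumCover (H K : Graph) (eH : E H) (eK : E K) (s : Bool) (u : V H)
                   (looplessH : Loopless H) (cubicH : Cubic H) (cubicK : Cubic K)
                   {col : E K → Fin 3} (properK : Proper K col)
                   (ιG : HalfAt (twoSum H K eH eK s) (inj₁ u) ↔ Fin 3) where

  open TwoSum H K eH eK s
  open InflationTransport G H (halfAtH↔ u) ιG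

  module _ (coverHᵘ : CoverBy IY.Xʷ 4) where

    private
      Ms = proj₁ coverHᵘ
      perfect = proj₁ (proj₂ coverHᵘ)
      covered = proj₂ (proj₂ coverHᵘ)

      unique : ∀ i v → UniqueMatch IY.Xʷ (Ms i) v
      unique i = perfectMatching⇒unique IY.Xʷ (Ms i) (perfect i)

      b₀ = proj₁ (endpoint-avoiding H looplessH eH u)
      a = end H eH b₀
      a≢u : False (_≟V_ H a u)
      a≢u = fromWitnessFalse (proj₂ (endpoint-avoiding H looplessH eH u))

      matched-at-a : ∀ i (h h' : HalfAt H a) →
        Ms i (inj₁ (edge h)) ≡ true → Ms i (inj₁ (edge h')) ≡ true → h ≡ h'
      matched-at-a i h h' m m' = from-injective atA↔
        (proj₂ (unique i (inj₁ (a , a≢u))) (from atA↔ h , m) (from atA↔ h' , m'))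
        where atA↔ = IY.halfAt-outside↔ a a≢u

      hₑ : HalfAt H a
      hₑ = (eH , b₀) , refl

      others = otherHalves H (cubicH a) hₑ
      h₁ = proj₁ others
      h₂ = proj₁ (proj₂ others)
      h₁≢hₑ = proj₁ (proj₂ (proj₂ others))
      h₂≢hₑ = proj₁ (proj₂ (proj₂ (proj₂ others)))

      m₁ m₂ : Fin 4
      m₁ = proj₁ (covered (inj₁ (edge h₁)))
      m₂ = proj₁ (covered (inj₁ (edge h₂)))

      avoids-eH : ∀ {i} (h : HalfAt H a) → h ≢ hₑ →
        Ms i (inj₁ (edge h)) ≡ true → Ms i (inj₁ eH) ≡ false
      avoids-eH {i} h h≢hₑ m with Ms i (inj₁ eH) in eq
      ... | false = refl
      ... | true = ⊥-elim (h≢hₑ (matched-at-a i h hₑ m eq))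

      m₁≢m₂ : m₁ ≢ m₂
      m₁≢m₂ m₁≡m₂ = proj₂ (proj₂ (proj₂ (proj₂ others)))
        (matched-at-a m₁ h₁ h₂ (proj₂ (covered _))
        (subst (λ i → Ms i (inj₁ (edge h₂)) ≡ true) (sym m₁≡m₂) (proj₂ (covered _))))

      c₀ = col eK
      r₁ = proj₁ (otherColours c₀)
      r₂ = proj₁ (proj₂ (otherColours c₀))
      r₁≢c₀ = proj₁ (proj₂ (proj₂ (otherColours c₀)))
      r₂≢c₀ = proj₁ (proj₂ (proj₂ (proj₂ (otherColours c₀))))
      r₁≢r₂ = proj₂ (proj₂ (proj₂ (proj₂ (otherColours c₀))))

      kColour′ : Bool → Fin 4 → Fin 3
      kColour′ true i = c₀
      kColour′ false i = if does (i ≟ m₁) then r₁ else r₂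

      kColour : Fin 4 → Fin 3
      kColour i = kColour′ (Ms i (inj₁ eH)) i

      kColour-eK : ∀ i → colourClass {K} col (kColour i) eK ≡ Ms i (inj₁ eH)
      kColour-eK i with Ms i (inj₁ eH)
      ... | true = dec-true (c₀ ≟ c₀) refl
      ... | false with i ≟ m₁
      ... | yes _ = dec-false (c₀ ≟ r₁) (r₁≢c₀ ∘ sym)
      ... | no _ = dec-false (c₀ ≟ r₂) (r₂≢c₀ ∘ sym)

      kColour-onto : ∀ z → Σ (Fin 4) λ i → kColour i ≡ z
      kColour-onto z with fin3-cases z (r₁≢c₀ ∘ sym) (r₂≢c₀ ∘ sym) r₁≢r₂
      ... | inj₁ refl = i₀ , cong (λ b → kColour′ b i₀) (proj₂ (covered (inj₁ eH)))
        where i₀ = proj₁ (covered (inj₁ eH))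
      ... | inj₂ (inj₁ refl) = m₁ ,
        trans (cong (λ b → kColour′ b m₁) (avoids-eH h₁ h₁≢hₑ (proj₂ (covered _))))
                                       (cong (if_then r₁ else r₂) (dec-true (m₁ ≟ m₁) refl))
      ... | inj₂ (inj₂ refl) = m₂ ,
        trans (cong (λ b → kColour′ b m₂) (avoids-eH h₂ h₂≢hₑ (proj₂ (covered _))))
                                       (cong (if_then r₁ else r₂) (dec-false (m₂ ≟ m₁) (m₁≢m₂ ∘ sym)))

    M : Fin 4 → E IX.Xʷ → Bool
    M i (inj₁ (inj₁ (e , _))) = Ms i (inj₁ e)
    M i (inj₁ (inj₂ (inj₁ (e , _)))) = colourClass {K} col (kColour i) e
    M i (inj₁ (inj₂ (inj₂ _))) = Ms i (inj₁ eH)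
    M i (inj₂ t) = Ms i (inj₂ t)

    module _ (i : Fin 4) where

      sideH↔ : ∀ v q q′ → HalfAt IX.Xʷ (inj₁ (inj₁ v , q)) ↔ HalfAt IY.Xʷ (inj₁ (v , q′))
      sideH↔ v q q′ =
        ↔-trans (IX.halfAt-outside↔ (inj₁ v) q) (↔-trans (halfAtH↔ v) (↔-sym (IY.halfAt-outside↔ v q′)))

      sideK↔ : ∀ k q → HalfAt IX.Xʷ (inj₁ (inj₂ k , q)) ↔ HalfAt K k
      sideK↔ k q = ↔-trans (IX.halfAt-outside↔ (inj₂ k) q) (halfAtK↔ k)

      M-sideH : ∀ v q q′ (h : HalfAt IX.Xʷ (inj₁ (inj₁ v , q))) →
        M i (edge h) ≡ Ms i (edge (to (sideH↔ v q q′) h))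
      M-sideH v q q′ ((inj₁ (inj₁ _) , b) , p) = refl
      M-sideH v q q′ ((inj₁ (inj₂ (inj₁ (e , e≢))) , b) , p)
        with () ← IX.end-outside⇒ (inj₂ (inj₁ (e , e≢))) b q p
      M-sideH v q q′ ((inj₁ (inj₂ (inj₂ _)) , false) , p) = refl
      M-sideH v q q′ ((inj₁ (inj₂ (inj₂ j)) , true) , p)
        with () ← IX.end-outside⇒ (connector j) true q p
      M-sideH v q q′ ((inj₂ _ , false) , ())
      M-sideH v q q′ ((inj₂ _ , true) , ())

      M-sideK : ∀ k q (h : HalfAt IX.Xʷ (inj₁ (inj₂ k , q))) →
        M i (edge h) ≡ colourClass {K} col (kColour i) (edge (to (sideK↔ k q) h))
      M-sideK k q ((inj₁ (inj₁ (e , e≢)) , b) , p)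
        with () ← IX.end-outside⇒ (inj₁ (e , e≢)) b q p
      M-sideK k q ((inj₁ (inj₂ (inj₁ _)) , b) , p) = refl
      M-sideK k q ((inj₁ (inj₂ (inj₂ j)) , false) , p)
        with () ← IX.end-outside⇒ (connector j) false q p
      M-sideK k q ((inj₁ (inj₂ (inj₂ _)) , true) , p) = sym (kColour-eK i)
      M-sideK k q ((inj₂ _ , false) , ())
      M-sideK k q ((inj₂ _ , true) , ())

      M-triangle : ∀ t (h : HalfAt IX.Xʷ (inj₂ t)) → M i (edge h) ≡ Ms i (edge (to (triangle-halfAt↔ t) h))
      M-triangle t ((inj₁ (inj₁ _) , b) , p) = refl
      M-triangle t ((inj₁ (inj₂ (inj₁ (e , e≢))) , b) , p)
        with () ← proj₁ (IX.end-triangle⇒ (inj₂ (inj₁ (e , e≢))) b t p)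
      M-triangle t ((inj₁ (inj₂ (inj₂ _)) , false) , p) = refl
      M-triangle t ((inj₁ (inj₂ (inj₂ j)) , true) , p)
        with () ← proj₁ (IX.end-triangle⇒ (connector j) true t p)
      M-triangle t ((inj₂ _ , false) , p) = refl
      M-triangle t ((inj₂ _ , true) , p) = refl

      M-unique : ∀ v → UniqueMatch IX.Xʷ (M i) v
      M-unique (inj₁ (inj₁ v , q)) =
        uniqueMatch-transport IX.Xʷ IY.Xʷ (sideH↔ v q q′) (M-sideH v q q′) (unique i (inj₁ (v , q′)))
        where
        q′ : False (_≟V_ H v u)
        q′ = fromWitnessFalse (λ v≡u → toWitnessFalse q (cong inj₁ v≡u))
      M-unique (inj₁ (inj₂ k , q)) =
        uniqueMatch-transport IX.Xʷ K (sideK↔ k q) (M-sideK k q) (colourClass-unique K properK (cubicK k) (kColour i))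
      M-unique (inj₂ t) =
        uniqueMatch-transport IX.Xʷ IY.Xʷ (triangle-halfAt↔ t) (M-triangle t) (unique i (inj₂ t))

    M-covers : ∀ e → Σ (Fin 4) λ i → M i e ≡ true
    M-covers (inj₁ (inj₁ (e , _))) = covered (inj₁ e)
    M-covers (inj₁ (inj₂ (inj₁ (e , _)))) with kColour-onto (col e)
    ... | i , colour≡ = i , dec-true (col e ≟ kColour i) (sym colour≡)
    M-covers (inj₁ (inj₂ (inj₂ _))) = covered (inj₁ eH)
    M-covers (inj₂ t) = covered (inj₂ t)

    cover : CoverBy IX.Xʷ 4
    cover = M , (λ i → unique⇒perfectMatching IX.Xʷ (M i) (M-unique i)) , M-covers

notAt : (X : Graph) {z : V X} (e : E X) (b : Bool) →
  False (_≟V_ X (end X e b) z) → False (_≟V_ X (end X e (not b)) z) → NotAt X z e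
notAt X e false p q = p , q
notAt X e true p q = q , p

notAt-end : (X : Graph) {z : V X} {e : E X} → NotAt X z e → (b : Bool) → False (_≟V_ X (end X e b) z)
notAt-end X n false = proj₁ n
notAt-end X n true = proj₂ n

notAt-irrelevant : (X : Graph) {z : V X} {e : E X} (n n' : NotAt X z e) → n ≡ n'
notAt-irrelevant X (p , q) (p' , q') = cong₂ _,_ (False-irr p p') (False-irr q q')

module ThreeSum (H K : Graph) (x : V H) (y : V K) (φ : HalfAt H x ↔ HalfAt K y)
                (looplessH : Loopless H) (looplessK : Loopless K) where

  G : Graph
  G = threeSum H K x y φ looplessH looplessK

  connector : HalfAt H x → E G
  connector h = inj₂ (inj₂ h)

  end-keptH : ∀ e (n : NotAt H x e) b → end G (inj₁ (e , n)) b ≡ inj₁ (end H e b , notAt-end H n b)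
  end-keptH e (p , q) false = refl
  end-keptH e (p , q) true = refl

  end-keptK : ∀ e (n : NotAt K y e) b → end G (inj₂ (inj₁ (e , n))) b ≡ inj₂ (end K e b , notAt-end K n b)
  end-keptK e (p , q) false = refl
  end-keptK e (p , q) true = refl

  halfAtH↔ : (v : V H) (v≢x : False (_≟V_ H v x)) → HalfAt G (inj₁ (v , v≢x)) ↔ HalfAt H v
  halfAtH↔ v v≢x = mkHalfAt↔ G H f g fg gf
    where
    f : HalfAt G (inj₁ (v , v≢x)) → HalfAt H v
    f ((inj₁ (e , n) , b) , p) = (e , b) , cong proj₁ (⊎P.inj₁-injective (trans (sym (end-keptH e n b)) p))
    f ((inj₂ (inj₂ ((e , b) , _)) , false) , p) = (e , not b) , cong proj₁ (⊎P.inj₁-injective p)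
    f ((inj₂ (inj₁ (_ , _ , _)) , false) , ())
    f ((inj₂ (inj₁ (_ , _ , _)) , true) , ())
    f ((inj₂ (inj₂ _) , true) , ())
    g′ : ∀ e b → end H e b ≡ v → Dec (end H e (not b) ≡ x) → HalfAt G (inj₁ (v , v≢x))
    g′ e b p (yes at-x) = (connector ((e , not b) , at-x) , false) ,
      cong inj₁ (del-≡ {_≟A_ = _≟V_ H} (trans (cong (end H e) (BoolP.not-involutive b)) p))
    g′ e b p (no ¬at-x) =
      (inj₁ (e , notAt H e b (fromWitnessFalse (λ at-x → toWitnessFalse v≢x (trans (sym p) at-x)))
                             (fromWitnessFalse ¬at-x)) , b) ,
      trans (end-keptH e _ b) (cong inj₁ (del-≡ {_≟A_ = _≟V_ H} p))
    g : HalfAt H v → HalfAt G (inj₁ (v , v≢x))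
    g ((e , b) , p) = g′ e b p (_≟V_ H (end H e (not b)) x)
    fg : ∀ h → proj₁ (f (g h)) ≡ proj₁ h
    fg ((e , b) , p) with _≟V_ H (end H e (not b)) x
    ... | yes _ = cong (e ,_) (BoolP.not-involutive b)
    ... | no _ = refl
    g′-kept : ∀ e b p d (n : NotAt H x e) → proj₁ (g′ e b p d) ≡ (inj₁ (e , n) , b)
    g′-kept e b p (yes at-x) n = ⊥-elim (toWitnessFalse (notAt-end H n (not b)) at-x)
    g′-kept e b p (no _) n = cong (λ n′ → inj₁ (e , n′) , b) (notAt-irrelevant H _ _)
    g′-connector : ∀ e b p d (at-x : end H e b ≡ x) →
      proj₁ (g′ e (not b) p d) ≡ (connector ((e , b) , at-x) , false)
    g′-connector e b p (yes _) at-x =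
      cong (λ h → connector h , false) (halfAt-≡ H (cong (e ,_) (BoolP.not-involutive b)))
    g′-connector e b p (no ¬at-x) at-x = ⊥-elim (¬at-x (trans (cong (end H e) (BoolP.not-involutive b)) at-x))
    gf : ∀ h → proj₁ (g (f h)) ≡ proj₁ h
    gf ((inj₁ (e , n) , b) , p) = g′-kept e b _ (_≟V_ H (end H e (not b)) x) n
    gf ((inj₂ (inj₂ ((e , b) , at-x)) , false) , p) = g′-connector e b _ (_≟V_ H (end H e (not (not b))) x) at-x

  halfAtK↔ : (k : V K) (k≢y : False (_≟V_ K k y)) → HalfAt G (inj₂ (k , k≢y)) ↔ HalfAt K k
  halfAtK↔ k k≢y = mkHalfAt↔ G K f g fg gf
    where
    f : HalfAt G (inj₂ (k , k≢y)) → HalfAt K k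
    f ((inj₂ (inj₁ (e , n)) , b) , p) =
      (e , b) , cong proj₁ (⊎P.inj₂-injective (trans (sym (end-keptK e n b)) p))
    f ((inj₂ (inj₂ h) , true) , p) = (edge (to φ h) , not (side (to φ h))) , cong proj₁ (⊎P.inj₂-injective p)
    f ((inj₁ (_ , _ , _) , false) , ())
    f ((inj₁ (_ , _ , _) , true) , ())
    f ((inj₂ (inj₂ _) , false) , ())
    g′ : ∀ e b → end K e b ≡ k → Dec (end K e (not b) ≡ y) → HalfAt G (inj₂ (k , k≢y))
    g′ e b p (yes at-y) = (connector (from φ ((e , not b) , at-y)) , true) ,
      cong inj₂ (trans (cong (otherEnd K looplessK y) (strictlyInverseˡ φ _))
                       (del-≡ {_≟A_ = _≟V_ K} (trans (cong (end K e) (BoolP.not-involutive b)) p)))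
    g′ e b p (no ¬at-y) =
      (inj₂ (inj₁ (e , notAt K e b (fromWitnessFalse (λ at-y → toWitnessFalse k≢y (trans (sym p) at-y)))
                                   (fromWitnessFalse ¬at-y))) , b) ,
      trans (end-keptK e _ b) (cong inj₂ (del-≡ {_≟A_ = _≟V_ K} p))
    g : HalfAt K k → HalfAt G (inj₂ (k , k≢y))
    g ((e , b) , p) = g′ e b p (_≟V_ K (end K e (not b)) y)
    fg : ∀ h → proj₁ (f (g h)) ≡ proj₁ h
    fg ((e , b) , p) with _≟V_ K (end K e (not b)) y
    ... | yes at-y = trans (cong (λ h → edge h , not (side h)) (strictlyInverseˡ φ ((e , not b) , at-y)))
                           (cong (e ,_) (BoolP.not-involutive b))
    ... | no _ = refl
    g′-kept : ∀ e b p d (n : NotAt K y e) → proj₁ (g′ e b p d) ≡ (inj₂ (inj₁ (e , n)) , b)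
    g′-kept e b p (yes at-y) n = ⊥-elim (toWitnessFalse (notAt-end K n (not b)) at-y)
    g′-kept e b p (no _) n = cong (λ n′ → inj₂ (inj₁ (e , n′)) , b) (notAt-irrelevant K _ _)
    g′-connector : ∀ h p d → proj₁ (g′ (edge (to φ h)) (not (side (to φ h))) p d) ≡ (connector h , true)
    g′-connector h p (yes _) = cong (λ h′ → connector h′ , true)
      (trans (cong (from φ) (halfAt-≡ K (cong (edge (to φ h) ,_) (BoolP.not-involutive (side (to φ h))))))
             (strictlyInverseʳ φ h))
    g′-connector h p (no ¬at-y) =
      ⊥-elim (¬at-y (trans (cong (end K (edge (to φ h))) (BoolP.not-involutive (side (to φ h)))) (proj₂ (to φ h))))
    gf : ∀ h → proj₁ (g (f h)) ≡ proj₁ h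
    gf ((inj₂ (inj₁ (e , n)) , b) , p) = g′-kept e b _ (_≟V_ K (end K e (not b)) y) n
    gf ((inj₂ (inj₂ h) , true) , p) =
      g′-connector h _ (_≟V_ K (end K (edge (to φ h)) (not (not (side (to φ h))))) y)

  connector-injective : ∀ {h h'} → connector h ≡ connector h' → h ≡ h'
  connector-injective refl = refl

  endK : HalfAt H x → V K
  endK h = end K (edge (to φ h)) (not (side (to φ h)))

  endK≢y : ∀ h → endK h ≢ y
  endK≢y h at-y = loopless-ends K looplessK (edge (to φ h)) (side (to φ h)) (trans at-y (sym (proj₂ (to φ h))))

  -- As for 2-sums, σ z follows the z-coloured edges inside K; the deleted vertex y is kept as an extra
  -- fixed point so that σ z lives on the enumerated set V K.
  module Restriction {n : ℕ} (enumK : V K ↔ Fin n) (cubicH : Cubic H) (cubicK : Cubic K)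
                     {c : E G → Fin 3} (proper : Proper G c) where
    open Parity (_≟V_ K) enumK

    halfOfColour : (z : Fin 3) (k : V K) (k≢y : False (_≟V_ K k y)) →
      Σ (HalfAt G (inj₂ (k , k≢y))) λ h → c (edge h) ≡ z
    halfOfColour z k k≢y = colour-occurs G proper (↔-trans (halfAtK↔ k k≢y) (cubicK k)) z

    across : (k : V K) (k≢y : False (_≟V_ K k y)) → HalfAt G (inj₂ (k , k≢y)) → V K
    across k k≢y ((inj₂ (inj₁ (e , _)) , b) , _) = end K e (not b)
    across k k≢y ((inj₂ (inj₂ _) , true) , _) = k
    across k k≢y ((inj₁ (_ , _ , _) , false) , ())
    across k k≢y ((inj₁ (_ , _ , _) , true) , ())
    across k k≢y ((inj₂ (inj₂ _) , false) , ())

    σ′ : Fin 3 → (k : V K) → Dec (k ≡ y) → V K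
    σ′ z k (yes _) = k
    σ′ z k (no k≢y) = across k (fromWitnessFalse k≢y) (proj₁ (halfOfColour z k (fromWitnessFalse k≢y)))

    σ : Fin 3 → V K → V K
    σ z k = σ′ z k (_≟V_ K k y)

    σ′-y : ∀ z k → k ≡ y → (d : Dec (k ≡ y)) → σ′ z k d ≡ k
    σ′-y z k k≡y (yes _) = refl
    σ′-y z k k≡y (no k≢y) = ⊥-elim (k≢y k≡y)

    σ′-across : ∀ {z k} (k≢y : False (_≟V_ K k y)) (h : HalfAt G (inj₂ (k , k≢y))) → c (edge h) ≡ z →
      (d : Dec (k ≡ y)) → σ′ z k d ≡ across k k≢y h
    σ′-across k≢y h cz (yes k≡y) = ⊥-elim (toWitnessFalse k≢y k≡y)
    σ′-across {z} {k} k≢y h cz (no _) =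
      trans (cong (λ q → across k q (proj₁ (halfOfColour z k q))) (False-irr _ k≢y))
            (cong (across k k≢y)
                  (proper-halfAt-injective G proper _ h (trans (proj₂ (halfOfColour z k k≢y)) (sym cz))))

    σ-across : ∀ {z k} (k≢y : False (_≟V_ K k y)) (h : HalfAt G (inj₂ (k , k≢y))) → c (edge h) ≡ z →
      σ z k ≡ across k k≢y h
    σ-across {k = k} k≢y h cz = σ′-across k≢y h cz (_≟V_ K k y)

    σ-back : ∀ {z k} (k≢y : False (_≟V_ K k y)) (h : HalfAt G (inj₂ (k , k≢y))) → c (edge h) ≡ z →
      σ z (across k k≢y h) ≡ k
    σ-back k≢y ((inj₂ (inj₁ (e , n)) , b) , p) cz =
      trans (σ-across (notAt-end K n (not b)) ((inj₂ (inj₁ (e , n)) , not b) , end-keptK e n (not b)) cz)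
            (trans (cong (end K e) (BoolP.not-involutive b))
                   (cong proj₁ (⊎P.inj₂-injective (trans (sym (end-keptK e n b)) p))))
    σ-back k≢y h@((inj₂ (inj₂ _) , true) , _) cz = σ-across k≢y h cz
    σ-back k≢y ((inj₁ (_ , _ , _) , false) , ()) cz
    σ-back k≢y ((inj₁ (_ , _ , _) , true) , ()) cz
    σ-back k≢y ((inj₂ (inj₂ _) , false) , ()) cz

    σ-involutive : ∀ z k → σ z (σ z k) ≡ k
    σ-involutive z k with _≟V_ K k y
    ... | yes k≡y = σ′-y z k k≡y (_≟V_ K k y)
    ... | no k≢y = σ-back (fromWitnessFalse k≢y) (proj₁ (halfOfColour z k _)) (proj₂ (halfOfColour z k _))

    stays⇒connector : ∀ {z k} (k≢y : False (_≟V_ K k y)) (h : HalfAt G (inj₂ (k , k≢y))) →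
      c (edge h) ≡ z → across k k≢y h ≡ k → Σ (HalfAt H x) λ hx → c (connector hx) ≡ z × k ≡ endK hx
    stays⇒connector k≢y ((inj₂ (inj₁ (e , n)) , b) , p) cz stays = ⊥-elim (loopless-ends K looplessK e b
      (trans stays (sym (cong proj₁ (⊎P.inj₂-injective (trans (sym (end-keptK e n b)) p))))))
    stays⇒connector k≢y ((inj₂ (inj₂ hx) , true) , p) cz stays =
      hx , cz , sym (cong proj₁ (⊎P.inj₂-injective p))
    stays⇒connector k≢y ((inj₁ (_ , _ , _) , false) , ()) cz stays
    stays⇒connector k≢y ((inj₁ (_ , _ , _) , true) , ()) cz stays
    stays⇒connector k≢y ((inj₂ (inj₂ _) , false) , ()) cz stays

    σ-y : ∀ z → σ z y ≡ y
    σ-y z = σ′-y z y refl (_≟V_ K y y)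

    fixed⇒connector : ∀ {z k} (k≢y : False (_≟V_ K k y)) → σ z k ≡ k →
      Σ (HalfAt H x) λ hx → c (connector hx) ≡ z × k ≡ endK hx
    fixed⇒connector {z} {k} k≢y stays =
      stays⇒connector k≢y (proj₁ h₀) (proj₂ h₀)
                      (trans (sym (σ-across k≢y (proj₁ h₀) (proj₂ h₀))) stays)
      where h₀ = halfOfColour z k k≢y

    connectorHalf : ∀ {k} (k≢y : False (_≟V_ K k y)) hx → k ≡ endK hx → HalfAt G (inj₂ (k , k≢y))
    connectorHalf k≢y hx k≡ = (connector hx , true) , cong inj₂ (del-≡ {_≟A_ = _≟V_ K} (sym k≡))

    connector⇒fixed : ∀ {z k} (k≢y : False (_≟V_ K k y)) hx →
      c (connector hx) ≡ z → k ≡ endK hx → σ z k ≡ k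
    connector⇒fixed k≢y hx cz k≡ = σ-across k≢y (connectorHalf k≢y hx k≡) cz

    connector-unique : ∀ {z k} (k≢y : False (_≟V_ K k y)) {hx hx'} →
      c (connector hx) ≡ z → k ≡ endK hx → c (connector hx') ≡ z → k ≡ endK hx' → hx ≡ hx'
    connector-unique k≢y cz k≡ cz' k≡' = connector-injective (cong edge (proper-halfAt-injective G proper
      (connectorHalf k≢y _ k≡) (connectorHalf k≢y _ k≡') (trans cz (sym cz'))))

    hx : Fin 3 → HalfAt H x
    hx = from (cubicH x)

    ConnectorAt : Fin 3 → Fin 3 → V K → Set
    ConnectorAt t z k = c (connector (hx t)) ≡ z × k ≡ endK (hx t)

    connectorAt? : ∀ t z k → Dec (ConnectorAt t z k)
    connectorAt? t z k = (c (connector (hx t)) ≟ z) ×-dec (_≟V_ K k (endK (hx t)))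

    connectorAt-y : ∀ t z → does (connectorAt? t z y) ≡ false
    connectorAt-y t z = dec-false (connectorAt? t z y) λ (_ , at-y) → endK≢y (hx t) (sym at-y)

    connectorAt-moving : ∀ {z k} (k≢y : False (_≟V_ K k y)) → σ z k ≢ k →
      ∀ t → does (connectorAt? t z k) ≡ false
    connectorAt-moving k≢y moves t =
      dec-false (connectorAt? _ _ _) λ (cz , k≡) → moves (connector⇒fixed k≢y (hx t) cz k≡)

    connectorAt-fixed : ∀ {z k} (k≢y : False (_≟V_ K k y)) hx* → c (connector hx*) ≡ z → k ≡ endK hx* →
      ∀ t → does (connectorAt? t z k) ≡ does (t ≟ to (cubicH x) hx*)
    connectorAt-fixed k≢y hx* cz* k≡* t = does-⇔ (mk⇔ only-hx* is-hx*) (connectorAt? _ _ _) (t ≟ _)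
      where
      only-hx* : ConnectorAt t _ _ → t ≡ to (cubicH x) hx*
      only-hx* (cz , k≡) =
        trans (sym (strictlyInverseˡ (cubicH x) t)) (cong (to (cubicH x)) (connector-unique k≢y cz k≡ cz* k≡*))
      is-hx* : t ≡ to (cubicH x) hx* → ConnectorAt t _ _
      is-hx* refl rewrite strictlyInverseʳ (cubicH x) hx* = cz* , k≡*

    fixedPoints : Fin 3 → V K → Bool
    fixedPoints z k = does (_≟V_ K (σ z k) k)

    fixedPoints-connectors : ∀ z k → fixedPoints z k ≡ does (_≟V_ K k y) xor ∑[ t < 3 ] does (connectorAt? t z k)
    fixedPoints-connectors z k = by-y (_≟V_ K k y)
      where
      by-y : (d : Dec (k ≡ y)) → fixedPoints z k ≡ does d xor ∑[ t < 3 ] does (connectorAt? t z k)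
      by-y (yes refl) = trans (dec-true (_≟V_ K (σ z y) y) (σ-y z))
                              (sym (cong (true xor_) (∑-false (λ t → connectorAt-y t z))))
      by-y (no k≢y) with _≟V_ K (σ z k) k
      ... | no moves = sym (∑-false (connectorAt-moving (fromWitnessFalse k≢y) moves))
      ... | yes stays with fixed⇒connector (fromWitnessFalse k≢y) stays
      ... | hx* , cz* , k≡* = sym (trans (sum-cong-≗ (connectorAt-fixed (fromWitnessFalse k≢y) hx* cz* k≡*))
                                         (∑-indicator (to (cubicH x) hx*)))

    parity-fixedPoints : ∀ z → parity (fixedPoints z) ≡ true xor ∑[ t < 3 ] does (c (connector (hx t)) ≟ z)
    parity-fixedPoints z = begin
      parity (fixedPoints z)
        ≡⟨ parity-cong (fixedPoints-connectors z) ⟩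
      parity (λ k → does (_≟V_ K k y) xor ∑[ t < 3 ] does (connectorAt? t z k))
        ≡⟨ parity-xor (λ k → does (_≟V_ K k y)) (λ k → ∑[ t < 3 ] does (connectorAt? t z k)) ⟩
      parity (λ k → does (_≟V_ K k y)) xor parity (λ k → ∑[ t < 3 ] does (connectorAt? t z k))
        ≡⟨ cong₂ _xor_ (parity-singleton y) (parity-∑ (λ t k → does (connectorAt? t z k))) ⟩
      true xor ∑[ t < 3 ] parity (λ k → does (connectorAt? t z k))
        ≡⟨ cong (true xor_) (sum-cong-≗ parity-connectorAt) ⟩
      true xor ∑[ t < 3 ] does (c (connector (hx t)) ≟ z)
        ∎
      where
      open ≡-Reasoning
      parity-connectorAt : ∀ t → parity (λ k → does (connectorAt? t z k)) ≡ does (c (connector (hx t)) ≟ z)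
      parity-connectorAt t = trans (parity-∧ colour-z (λ k → does (_≟V_ K k (endK (hx t)))))
        (trans (cong (colour-z ∧_) (parity-singleton (endK (hx t)))) (BoolP.∧-identityʳ colour-z))
        where colour-z = does (c (connector (hx t)) ≟ z)

    connectors-distinctColours : ∀ t t' → c (connector (hx t)) ≡ c (connector (hx t')) → t ≡ t'
    connectors-distinctColours = balanced-colours-injective (λ t → c (connector (hx t))) λ z z' →
      BoolP.not-injective (begin
        true xor _  ≡⟨ parity-fixedPoints z ⟨
        parity (fixedPoints z)  ≡⟨ involution-parity (σ z) (σ-involutive z) ⟩
        parity (λ _ → true)     ≡⟨ involution-parity (σ z') (σ-involutive z') ⟨
        parity (fixedPoints z') ≡⟨ parity-fixedPoints z' ⟩
        true xor _  ∎)
      where open ≡-Reasoning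

    colourH′ : ∀ e → Dec (end H e false ≡ x) → Dec (end H e true ≡ x) → Fin 3
    colourH′ e (yes at-x) _ = c (connector ((e , false) , at-x))
    colourH′ e (no _) (yes at-x) = c (connector ((e , true) , at-x))
    colourH′ e (no ¬at-x) (no ¬at-x′) = c (inj₁ (e , fromWitnessFalse ¬at-x , fromWitnessFalse ¬at-x′))

    colourH : E H → Fin 3
    colourH e = colourH′ e (_≟V_ H (end H e false) x) (_≟V_ H (end H e true) x)

    colourH-at : ∀ {v} (v≢x : False (_≟V_ H v x)) (h : HalfAt H v) →
      c (edge (from (halfAtH↔ v v≢x) h)) ≡ colourH (edge h)
    colourH-at v≢x ((e , false) , p) with _≟V_ H (end H e false) x | _≟V_ H (end H e true) x
    ... | yes at-x | _ = ⊥-elim (toWitnessFalse v≢x (trans (sym p) at-x))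
    ... | no _ | yes _ = refl
    ... | no _ | no _ = cong (λ n → c (inj₁ (e , n))) (notAt-irrelevant H _ _)
    colourH-at v≢x ((e , true) , p) with _≟V_ H (end H e false) x | _≟V_ H (end H e true) x
    ... | yes _ | _ = refl
    ... | no _ | yes at-x = ⊥-elim (toWitnessFalse v≢x (trans (sym p) at-x))
    ... | no _ | no _ = cong (λ n → c (inj₁ (e , n))) (notAt-irrelevant H _ _)

    colourH-atX : (h : HalfAt H x) → colourH (edge h) ≡ c (connector h)
    colourH-atX ((e , false) , p) with _≟V_ H (end H e false) x
    ... | yes _ = cong (c ∘ connector) (halfAt-≡ H refl)
    ... | no ¬at-x = ⊥-elim (¬at-x p)
    colourH-atX ((e , true) , p) with _≟V_ H (end H e false) x | _≟V_ H (end H e true) x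
    ... | yes at-x | _ = ⊥-elim (looplessH e (trans at-x (sym p)))
    ... | no _ | yes _ = cong (c ∘ connector) (halfAt-≡ H refl)
    ... | no _ | no ¬at-x = ⊥-elim (¬at-x p)

    proper-restrictH : Proper H colourH
    proper-restrictH (e , b) (e' , b') neq ends same with _≟V_ H (end H e b) x
    ... | no ¬at-x = neq (cong proj₁ (from-injective (halfAtH↔ v v≢x) (proper-halfAt-injective G proper _ _
          (trans (colourH-at v≢x h) (trans same (sym (colourH-at v≢x h')))))))
      where
      v = end H e b
      v≢x = fromWitnessFalse ¬at-x
      h h' : HalfAt H v
      h = (e , b) , refl
      h' = (e' , b') , sym ends
    ... | yes at-x = neq (cong proj₁ (to-injective (cubicH x) (connectors-distinctColours _ _
          (trans (cong (c ∘ connector) (strictlyInverseʳ (cubicH x) h))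
          (trans (sym (colourH-atX h)) (trans same (trans (colourH-atX h')
                 (cong (c ∘ connector) (sym (strictlyInverseʳ (cubicH x) h'))))))))))
      where
      h h' : HalfAt H x
      h = (e , b) , at-x
      h' = (e' , b') , trans (sym ends) at-x

threeSum-colourable⇒colourable : (H K : Graph) (x : V H) (y : V K) (φ : HalfAt H x ↔ HalfAt K y)
  (looplessH : Loopless H) (looplessK : Loopless K) → Σ ℕ (λ n → V K ↔ Fin n) → Cubic H → Cubic K →
  ThreeEdgeColourable (threeSum H K x y φ looplessH looplessK) → ThreeEdgeColourable H
threeSum-colourable⇒colourable H K x y φ looplessH looplessK (_ , enumK) cubicH cubicK (c , proper) =
  colourH , proper-restrictH
  where open ThreeSum.Restriction H K x y φ looplessH looplessK enumK cubicH cubicK proper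

-- Each matching of the covering of Hᵘ meets x in exactly one edge-end h; it is completed on the K side
-- by the colour class of the edge of K at y that corresponds to h under φ.
module ThreeSumCover (H K : Graph) (x : V H) (y : V K) (φ : HalfAt H x ↔ HalfAt K y)
                     (looplessH : Loopless H) (looplessK : Loopless K) (cubicK : Cubic K)
                     {col : E K → Fin 3} (properK : Proper K col)
                     (u : V H) (u≢x : False (_≟V_ H u x))
                     (ιG : HalfAt (threeSum H K x y φ looplessH looplessK) (inj₁ (u , u≢x)) ↔ Fin 3) where

  open ThreeSum H K x y φ looplessH looplessK
  open InflationTransport G H (halfAtH↔ u u≢x) ιG

  module _ (coverHᵘ : CoverBy IY.Xʷ 4) where

    private
      Ms = proj₁ coverHᵘ
      perfect = proj₁ (proj₂ coverHᵘ)
      covered = proj₂ (proj₂ coverHᵘ)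

      unique : ∀ i v → UniqueMatch IY.Xʷ (Ms i) v
      unique i = perfectMatching⇒unique IY.Xʷ (Ms i) (perfect i)

      x≢u : False (_≟V_ H x u)
      x≢u = fromWitnessFalse (λ x≡u → toWitnessFalse u≢x (sym x≡u))

      atX↔ : HalfAt IY.Xʷ (inj₁ (x , x≢u)) ↔ HalfAt H x
      atX↔ = IY.halfAt-outside↔ x x≢u

      matchedAtX : Fin 4 → HalfAt H x
      matchedAtX i = to atX↔ (proj₁ (proj₁ (unique i (inj₁ (x , x≢u)))))

      matchedAtX-matched : ∀ i → Ms i (inj₁ (edge (matchedAtX i))) ≡ true
      matchedAtX-matched i =
        trans (cong (Ms i) (sym (IY.edge-outside _))) (proj₂ (proj₁ (unique i (inj₁ (x , x≢u)))))

      matchedAtX-unique : ∀ i (h : HalfAt H x) → Ms i (inj₁ (edge h)) ≡ true → h ≡ matchedAtX i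
      matchedAtX-unique i h m = trans (sym (strictlyInverseˡ atX↔ h))
        (cong (to atX↔) (proj₂ (unique i (inj₁ (x , x≢u))) (from atX↔ h , m)
                                (proj₁ (unique i (inj₁ (x , x≢u))))))

      kColour : Fin 4 → Fin 3
      kColour i = col (edge (to φ (matchedAtX i)))

      connector-matched : ∀ i h → Ms i (inj₁ (edge h)) ≡ colourClass {K} col (kColour i) (edge (to φ h))
      connector-matched i h with Ms i (inj₁ (edge h)) in m
      ... | true = sym (dec-true (_ ≟ kColour i) (cong (λ h′ → col (edge (to φ h′))) (matchedAtX-unique i h m)))
      ... | false = sym (dec-false (_ ≟ kColour i) λ same → true≢false (trans (sym (matchedAtX-matched i))
              (trans (cong (λ h′ → Ms i (inj₁ (edge h′)))
                (sym (to-injective φ (proper-halfAt-injective K properK (to φ h) (to φ (matchedAtX i)) same)))) m)))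

      kColour-onto : ∀ z → Σ (Fin 4) λ i → kColour i ≡ z
      kColour-onto z = i ,
        trans (cong (λ h → col (edge (to φ h))) (sym (matchedAtX-unique i h (proj₂ (covered _)))))
              (trans (cong (col ∘ edge) (strictlyInverseˡ φ hy)) (proj₂ (colour-occurs K properK (cubicK y) z)))
        where
        hy = proj₁ (colour-occurs K properK (cubicK y) z)
        h = from φ hy
        i = proj₁ (covered (inj₁ (edge h)))

    M : Fin 4 → E IX.Xʷ → Bool
    M i (inj₁ (inj₁ (e , _))) = Ms i (inj₁ e)
    M i (inj₁ (inj₂ (inj₁ (e , _)))) = colourClass {K} col (kColour i) e
    M i (inj₁ (inj₂ (inj₂ h))) = Ms i (inj₁ (edge h))
    M i (inj₂ t) = Ms i (inj₂ t)

    module _ (i : Fin 4) where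

      sideH↔ : ∀ v v≢x q q′ →
        HalfAt IX.Xʷ (inj₁ (inj₁ (v , v≢x) , q)) ↔ HalfAt IY.Xʷ (inj₁ (v , q′))
      sideH↔ v v≢x q q′ =
        ↔-trans (IX.halfAt-outside↔ (inj₁ (v , v≢x)) q)
                (↔-trans (halfAtH↔ v v≢x) (↔-sym (IY.halfAt-outside↔ v q′)))

      sideK↔ : ∀ k k≢y q → HalfAt IX.Xʷ (inj₁ (inj₂ (k , k≢y) , q)) ↔ HalfAt K k
      sideK↔ k k≢y q = ↔-trans (IX.halfAt-outside↔ (inj₂ (k , k≢y)) q) (halfAtK↔ k k≢y)

      M-sideH : ∀ v v≢x q q′ (h : HalfAt IX.Xʷ (inj₁ (inj₁ (v , v≢x) , q))) →
        M i (edge h) ≡ Ms i (edge (to (sideH↔ v v≢x q q′) h))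
      M-sideH v v≢x q q′ ((inj₁ (inj₁ _) , b) , p) = refl
      M-sideH v v≢x q q′ ((inj₁ (inj₂ (inj₁ (e , n))) , b) , p)
        with () ← trans (sym (end-keptK e n b)) (IX.end-outside⇒ (inj₂ (inj₁ (e , n))) b q p)
      M-sideH v v≢x q q′ ((inj₁ (inj₂ (inj₂ _)) , false) , p) = refl
      M-sideH v v≢x q q′ ((inj₁ (inj₂ (inj₂ h)) , true) , p) with () ← IX.end-outside⇒ (connector h) true q p
      M-sideH v v≢x q q′ ((inj₂ _ , false) , ())
      M-sideH v v≢x q q′ ((inj₂ _ , true) , ())

      M-sideK : ∀ k k≢y q (h : HalfAt IX.Xʷ (inj₁ (inj₂ (k , k≢y) , q))) →
        M i (edge h) ≡ colourClass {K} col (kColour i) (edge (to (sideK↔ k k≢y q) h))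
      M-sideK k k≢y q ((inj₁ (inj₁ (e , n)) , b) , p)
        with () ← trans (sym (end-keptH e n b)) (IX.end-outside⇒ (inj₁ (e , n)) b q p)
      M-sideK k k≢y q ((inj₁ (inj₂ (inj₁ _)) , b) , p) = refl
      M-sideK k k≢y q ((inj₁ (inj₂ (inj₂ h)) , false) , p) with () ← IX.end-outside⇒ (connector h) false q p
      M-sideK k k≢y q ((inj₁ (inj₂ (inj₂ h)) , true) , p) = connector-matched i h
      M-sideK k k≢y q ((inj₂ _ , false) , ())
      M-sideK k k≢y q ((inj₂ _ , true) , ())

      M-triangle : ∀ t (h : HalfAt IX.Xʷ (inj₂ t)) → M i (edge h) ≡ Ms i (edge (to (triangle-halfAt↔ t) h))
      M-triangle t ((inj₁ (inj₁ _) , b) , p) = refl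
      M-triangle t ((inj₁ (inj₂ (inj₁ (e , n))) , b) , p)
        with () ← trans (sym (end-keptK e n b)) (proj₁ (IX.end-triangle⇒ (inj₂ (inj₁ (e , n))) b t p))
      M-triangle t ((inj₁ (inj₂ (inj₂ _)) , false) , p) = refl
      M-triangle t ((inj₁ (inj₂ (inj₂ h)) , true) , p) with () ← proj₁ (IX.end-triangle⇒ (connector h) true t p)
      M-triangle t ((inj₂ _ , false) , p) = refl
      M-triangle t ((inj₂ _ , true) , p) = refl

      M-unique : ∀ v → UniqueMatch IX.Xʷ (M i) v
      M-unique (inj₁ (inj₁ (v , v≢x) , q)) =
        uniqueMatch-transport IX.Xʷ IY.Xʷ (sideH↔ v v≢x q q′) (M-sideH v v≢x q q′)
                              (unique i (inj₁ (v , q′)))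
        where
        q′ : False (_≟V_ H v u)
        q′ = fromWitnessFalse (λ v≡u → toWitnessFalse q (cong inj₁ (del-≡ {_≟A_ = _≟V_ H} v≡u)))
      M-unique (inj₁ (inj₂ (k , k≢y) , q)) = uniqueMatch-transport IX.Xʷ K (sideK↔ k k≢y q) (M-sideK k k≢y q)
        (colourClass-unique K properK (cubicK k) (kColour i))
      M-unique (inj₂ t) =
        uniqueMatch-transport IX.Xʷ IY.Xʷ (triangle-halfAt↔ t) (M-triangle t) (unique i (inj₂ t))

    M-covers : ∀ e → Σ (Fin 4) λ i → M i e ≡ true
    M-covers (inj₁ (inj₁ (e , _))) = covered (inj₁ e)
    M-covers (inj₁ (inj₂ (inj₁ (e , _)))) with kColour-onto (col e)
    ... | i , colour≡ = i , dec-true (col e ≟ kColour i) (sym colour≡)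
    M-covers (inj₁ (inj₂ (inj₂ h))) = covered (inj₁ (edge h))
    M-covers (inj₂ t) = covered (inj₂ t)

    cover : CoverBy IX.Xʷ 4
    cover = M , (λ i → unique⇒perfectMatching IX.Xʷ (M i) (M-unique i)) , M-covers

twoSum-preserves-apex : (H K : Graph) (eH : E H) (eK : E K) (s : Bool) →
  Cubic H → Loopless H → ¬ ThreeEdgeColourable H →
  Σ ℕ (λ n → V K ↔ Fin n) → Cubic K → Loopless K → ThreeEdgeColourable K →
  (u : V H) → Apex H u → Apex (twoSum H K eH eK s) (inj₁ u)
twoSum-preserves-apex H K eH eK s cubicH looplessH uncolourableH enumK cubicK looplessK (_ , properK) u apex ιG =
  pmIndex≡4 (inflate (twoSum H K eH eK s) (inj₁ u) ιG)
    (TwoSumCover.cover H K eH eK s u looplessH cubicH cubicK properK ιG (proj₁ (apex ιH)))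
    λ colourable → uncolourableH (twoSum-colourable⇒colourable H K eH eK s enumK cubicK looplessK
                                   (inflate-colourable⇒colourable _ _ ιG colourable))
  where ιH = InflationTransport.ιY (twoSum H K eH eK s) H (TwoSum.halfAtH↔ H K eH eK s u) ιG

threeSum-preserves-apex : (H K : Graph) (x : V H) (y : V K) (φ : HalfAt H x ↔ HalfAt K y)
  (looplessH : Loopless H) (looplessK : Loopless K) → Cubic H → ¬ ThreeEdgeColourable H →
  Σ ℕ (λ n → V K ↔ Fin n) → Cubic K → ThreeEdgeColourable K →
  (u : V H) (u≢x : False (_≟V_ H u x)) → Apex H u →
  Apex (threeSum H K x y φ looplessH looplessK) (inj₁ (u , u≢x))
threeSum-preserves-apex H K x y φ looplessH looplessK cubicH uncolourableH enumK cubicK (_ , properK) u u≢x apex ιG =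
  pmIndex≡4 (inflate G (inj₁ (u , u≢x)) ιG)
    (ThreeSumCover.cover H K x y φ looplessH looplessK cubicK properK u u≢x ιG (proj₁ (apex ιH)))
    λ colourable → uncolourableH (threeSum-colourable⇒colourable H K x y φ looplessH looplessK enumK cubicH cubicK
                                   (inflate-colourable⇒colourable _ _ ιG colourable))
  where
  G = threeSum H K x y φ looplessH looplessK
  ιH = InflationTransport.ιY G H (ThreeSum.halfAtH↔ H K x y φ looplessH looplessK u u≢x) ιG

lemma6p6 : (H K : Graph) → Finite H → Finite K →
    (snH : Snark H) → PMIndexAtLeast H 5 →
    (tcK : TwoConnected K) (cuK : Cubic K) → ThreeEdgeColourable K →
    (u : V H) → Apex H u →
    ((eH : E H) (eK : E K) (s : Bool) →
      Apex (twoSum H K eH eK s) (inj₁ u))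
    × ((x : V H) (y : V K) (φ : HalfAt H x ↔ HalfAt K y) (u≢x : u ≢ x) →
      Apex (threeSum H K x y φ
              (loopless H (proj₁ (proj₂ snH)) (proj₁ snH))
              (loopless K cuK tcK))
           (inj₁ (u , fromWitnessFalse u≢x)))
lemma6p6 H K _ (enumK , _) (twoConnectedH , cubicH , uncolourableH) _ tcK cubicK colourableK u apex =
  (λ eH eK s → twoSum-preserves-apex H K eH eK s cubicH looplessH uncolourableH enumK cubicK looplessK
                 colourableK u apex) ,
  (λ x y φ u≢x → threeSum-preserves-apex H K x y φ looplessH looplessK cubicH uncolourableH enumK cubicK colourableK
                   u (fromWitnessFalse u≢x) apex)
  where
  looplessH = loopless H cubicH twoConnectedH
  looplessK = loopless K cubicK tcK
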